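{- Let $a+bi \in \mathbb{Z}[i]\setminus\{0\}$ and suppose $\phi_{\mathbb{Z}[i]}(a+bi) = 2k$ for an integer $k\geq 0$. Then there exist $u_0,\dots,u_{2k} \in \{0,\pm1,\pm i\}$ with $a+bi = \sum_{j=0}^{2k} u_j (1+i)^j$ such that the leading term can be chosen as follows, in each case whose condition holds: $u_{2k}(1+i)^{2k} = 2^k$ if $0\leq |b| \leq a$; $u_{2k}(1+i)^{2k} = -2^k$ if $0 \leq |b| \leq -a$; $u_{2k}(1+i)^{2k} = -2^k i$ if $0\leq |a| \leq -b$; $u_{2k}(1+i)^{2k} = 2^k i$ if $0 \leq |a| \leq b$.
   Context: For an integral domain $R$, a Euclidean function is a map $f: R\setminus\{0\} \to \mathbb{N}_0$ such that for all $a,b \in R\setminus\{0\}$ there exist $q,r\in R$ with $a = qb+r$ and either $r=0$ or $f(r)<f(b)$. $\phi_{\mathbb{Z}[i]}$ denotes the minimal Euclidean function on the Gaussian integers $\mathbb{Z}[i]$, i.e. the pointwise minimum of all Euclidean functions on $\mathbb{Z}[i]$. An expression $\sum_{j=0}^{n} u_j(1+i)^j$ with $u_j\in\{0,\pm1,\pm i\}$ is called a $(1+i)$-ary expansion of length $n+1$. -}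

module Defs where

open import Data.Nat as ℕ using (ℕ; zero; suc)
open import Data.Integer as ℤ using (ℤ; +_; -_)
open import Data.Fin using (Fin; toℕ)
open import Data.Product using (Σ; _×_; _,_; ∃)
open import Data.Sum using (_⊎_)
open import Relation.Binary.PropositionalEquality using (_≡_; _≢_)

record 𝔾 : Set where
  constructor _+_i
  field
    re : ℤ
    im : ℤ
open 𝔾 public

0𝔾 : 𝔾
0𝔾 = (+ 0) + (+ 0) i

1𝔾 : 𝔾
1𝔾 = (+ 1) + (+ 0) i

i𝔾 : 𝔾
i𝔾 = (+ 0) + (+ 1) i

infixl 6 _⊕_
infixl 7 _⊗_

_⊕_ : 𝔾 → 𝔾 → 𝔾
(a + b i) ⊕ (c + d i) = (a ℤ.+ c) + (b ℤ.+ d) i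

_⊗_ : 𝔾 → 𝔾 → 𝔾
(a + b i) ⊗ (c + d i) = (a ℤ.* c ℤ.- b ℤ.* d) + (a ℤ.* d ℤ.+ b ℤ.* c) i

⊖_ : 𝔾 → 𝔾
⊖ (a + b i) = (ℤ.- a) + (ℤ.- b) i

_^𝔾_ : 𝔾 → ℕ → 𝔾
x ^𝔾 zero = 1𝔾
x ^𝔾 suc n = x ⊗ (x ^𝔾 n)

1+i : 𝔾
1+i = (+ 1) + (+ 1) i

EuclFun : Set
EuclFun = (x : 𝔾) → x ≢ 0𝔾 → ℕ

IsEuclidean : EuclFun → Set
IsEuclidean f =
  (a b : 𝔾) (a≢0 : a ≢ 0𝔾) (b≢0 : b ≢ 0𝔾) →
  Σ 𝔾 λ q → Σ 𝔾 λ r →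
    (a ≡ q ⊗ b ⊕ r) ×
    ((r ≡ 0𝔾) ⊎ (Σ (r ≢ 0𝔾) λ r≢0 → f r r≢0 ℕ.< f b b≢0))

-- φ_{ℤ[i]}(x) = n : n is the pointwise minimum over all Euclidean functions
-- of their value at x (attained by some Euclidean function, and ≤ every one).
MinEuclValue : (x : 𝔾) → x ≢ 0𝔾 → ℕ → Set
MinEuclValue x x≢0 n =
  (Σ EuclFun λ f → IsEuclidean f × (f x x≢0 ≡ n)) ×
  ((f : EuclFun) → IsEuclidean f → n ℕ.≤ f x x≢0)

data Digit : Set where
  d0 d1 d-1 di d-i : Digit

digit : Digit → 𝔾
digit d0  = 0𝔾
digit d1  = 1𝔾
digit d-1 = ⊖ 1𝔾
digit di  = i𝔾
digit d-i = ⊖ i𝔾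

sumFin : (n : ℕ) → (Fin n → 𝔾) → 𝔾
sumFin zero    f = 0𝔾
sumFin (suc n) f = f Data.Fin.zero ⊕ sumFin n (λ j → f (Data.Fin.suc j))

expansion : (n : ℕ) → (Fin n → Digit) → 𝔾
expansion n u = sumFin n (λ j → digit (u j) ⊗ (1+i ^𝔾 toℕ j))

two^ : ℕ → 𝔾
two^ k = (+ (2 ℕ.^ k)) + (+ 0) i

ExpWithLead : 𝔾 → ℕ → 𝔾 → Set
ExpWithLead x k t =
  Σ (Fin (suc (2 ℕ.* k)) → Digit) λ u →
    (x ≡ expansion (suc (2 ℕ.* k)) u) ×
    (digit (u (Data.Fin.fromℕ (2 ℕ.* k))) ⊗ (1+i ^𝔾 (2 ℕ.* k)) ≡ t)

{-# OPTIONS --safe #-}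
-- Following Motzkin, every Gaussian integer x with φ(x) < m lies in an explicit set Motzkin m:
-- the products (1 + i)ʲ x′ with x′ odd and inside an octagon of level m - j. For y outside it
-- there is an a none of whose remainders modulo y is 0 or lies in Motzkin (m - 1). For odd y
-- take a = (1 + i)(y + 1)/2, so that 2r - (1 + i) = (1 + i - 2q) y for r = a - q y: a norm
-- estimate excludes every quotient q but four, and those would put y inside the octagon.
-- Conversely, if y ∈ Motzkin (m + 1) lies in the quarter-plane sector around d = iʲ (1 + i)ᵐ,
-- then y - d lies in Motzkin m or is 0: for odd y this is a linear estimate on octagons once d
-- is rotated to 2ᵏ or (1 + i) 2ᵏ, and for even y one divides by 1 + i. Iterating builds an
-- expansion of length m + 1 with leading term d. When φ(y) = 2k, each hypothesis of the theorem
-- places y in the sector around the unit multiple of (1 + i)²ᵏ that it asks for.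
module Submission where

open import Defs
open import Data.Nat using (ℕ; _*_)
open import Data.Integer using (ℤ; _≤_; ∣_∣; -_; +_)
open import Data.Product using (_×_)
open import Relation.Binary.PropositionalEquality using (_≢_)

open import Algebra.Bundles using (CommutativeRing)
open import Data.Empty using (⊥; ⊥-elim)
open import Data.Fin as Fin using (Fin; toℕ; fromℕ; inject₁)
import Data.Fin.Properties as Finₚ
open import Data.Integer using (_+_; _-_; _<_; _≤?_) renaming (_*_ to _·_)
import Data.Integer as ℤ
import Data.Integer.DivMod as ℤ
import Data.Integer.Properties as ℤₚ
open import Data.Integer.Tactic.RingSolver using (solve; solve-∀)
open import Data.List using (_∷_; [])
open import Data.Maybe using (Maybe; just; nothing)
open import Data.Nat as ℕ using (zero; suc)
import Data.Nat.Properties as ℕₚ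
open import Data.Product using (Σ; ∃-syntax; _,_; proj₁; proj₂)
open import Data.Sum using (_⊎_; inj₁; inj₂; [_,_]′)
open import Function using (_∘_)
open import Level using (0ℓ)
open import Relation.Binary.PropositionalEquality
  using (_≡_; refl; sym; trans; cong; cong₂; subst; subst₂; isEquivalence; module ≡-Reasoning)
open import Relation.Nullary using (¬_; Dec; yes; no; contradiction)
open import Relation.Nullary.Decidable using (_×-dec_)
open import Algebra.Structures {A = 𝔾} _≡_ using (IsCommutativeRing)
import Tactic.RingSolver as RingSolver
open import Tactic.RingSolver.Core.AlmostCommutativeRing using (AlmostCommutativeRing; fromCommutativeRing)

𝔾-isCommutativeRing : IsCommutativeRing _⊕_ _⊗_ ⊖_ 0𝔾 1𝔾
𝔾-isCommutativeRing = record
  { isRing = record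
    { +-isAbelianGroup = record
      { isGroup = record
        { isMonoid = record
          { isSemigroup = record
            { isMagma = record { isEquivalence = isEquivalence ; ∙-cong = cong₂ _⊕_ }
            ; assoc   = λ { (a + b i) (c + d i) (e + f i) →
                              cong₂ _+_i (ℤₚ.+-assoc a c e) (ℤₚ.+-assoc b d f) }
            }
          ; identity = (λ { (a + b i) → cong₂ _+_i (ℤₚ.+-identityˡ a) (ℤₚ.+-identityˡ b) })
                     , (λ { (a + b i) → cong₂ _+_i (ℤₚ.+-identityʳ a) (ℤₚ.+-identityʳ b) })
          }
        ; inverse = (λ { (a + b i) → cong₂ _+_i (ℤₚ.+-inverseˡ a) (ℤₚ.+-inverseˡ b) })
                  , (λ { (a + b i) → cong₂ _+_i (ℤₚ.+-inverseʳ a) (ℤₚ.+-inverseʳ b) })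
        ; ⁻¹-cong = cong ⊖_
        }
      ; comm = λ { (a + b i) (c + d i) → cong₂ _+_i (ℤₚ.+-comm a c) (ℤₚ.+-comm b d) }
      }
    ; *-cong     = cong₂ _⊗_
    ; *-assoc    = λ { (a + b i) (c + d i) (e + f i) →
                         cong₂ _+_i (*-assoc-re a b c d e f) (*-assoc-im a b c d e f) }
    ; *-identity = (λ { (a + b i) → cong₂ _+_i (*-identityˡ-re a b) (*-identityˡ-im a b) })
                 , (λ { (a + b i) → cong₂ _+_i (*-identityʳ-re a b) (*-identityʳ-im a b) })
    ; distrib    = (λ { (a + b i) (c + d i) (e + f i) →
                          cong₂ _+_i (distribˡ-re a b c d e f) (distribˡ-im a b c d e f) })
                 , (λ { (a + b i) (c + d i) (e + f i) →
                          cong₂ _+_i (distribʳ-re a b c d e f) (distribʳ-im a b c d e f) })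
    }
  ; *-comm = λ { (a + b i) (c + d i) → cong₂ _+_i (*-comm-re a b c d) (*-comm-im a b c d) }
  }
  where
  *-assoc-re : ∀ a b c d e f →
               (a · c - b · d) · e - (a · d + b · c) · f ≡ a · (c · e - d · f) - b · (c · f + d · e)
  *-assoc-re = solve-∀
  *-assoc-im : ∀ a b c d e f →
               (a · c - b · d) · f + (a · d + b · c) · e ≡ a · (c · f + d · e) + b · (c · e - d · f)
  *-assoc-im = solve-∀
  *-identityˡ-re : ∀ a b → + 1 · a - + 0 · b ≡ a
  *-identityˡ-re = solve-∀
  *-identityˡ-im : ∀ a b → + 1 · b + + 0 · a ≡ b
  *-identityˡ-im = solve-∀
  *-identityʳ-re : ∀ a b → a · + 1 - b · + 0 ≡ a
  *-identityʳ-re = solve-∀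
  *-identityʳ-im : ∀ a b → a · + 0 + b · + 1 ≡ b
  *-identityʳ-im = solve-∀
  distribˡ-re : ∀ a b c d e f → a · (c + e) - b · (d + f) ≡ (a · c - b · d) + (a · e - b · f)
  distribˡ-re = solve-∀
  distribˡ-im : ∀ a b c d e f → a · (d + f) + b · (c + e) ≡ (a · d + b · c) + (a · f + b · e)
  distribˡ-im = solve-∀
  distribʳ-re : ∀ a b c d e f → (c + e) · a - (d + f) · b ≡ (c · a - d · b) + (e · a - f · b)
  distribʳ-re = solve-∀
  distribʳ-im : ∀ a b c d e f → (c + e) · b + (d + f) · a ≡ (c · b + d · a) + (e · b + f · a)
  distribʳ-im = solve-∀
  *-comm-re : ∀ a b c d → a · c - b · d ≡ c · a - d · b
  *-comm-re = solve-∀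
  *-comm-im : ∀ a b c d → a · d + b · c ≡ c · b + d · a
  *-comm-im = solve-∀

𝔾-commutativeRing : CommutativeRing 0ℓ 0ℓ
𝔾-commutativeRing = record { isCommutativeRing = 𝔾-isCommutativeRing }

open CommutativeRing 𝔾-commutativeRing using ()
  renaming ( +-comm to ⊕-comm ; +-assoc to ⊕-assoc ; zeroˡ to ⊗-zeroˡ ; *-comm to ⊗-comm
           ; *-assoc to ⊗-assoc ; *-identityˡ to ⊗-identityˡ ; *-identityʳ to ⊗-identityʳ )

-- The coefficients the solver meets are closed terms, so a syntactic zero test suffices.
𝔾-ring : AlmostCommutativeRing 0ℓ 0ℓ
𝔾-ring = fromCommutativeRing 𝔾-commutativeRing is-0𝔾
  where
  is-0𝔾 : ∀ x → Maybe (0𝔾 ≡ x)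
  is-0𝔾 ((+ 0) + (+ 0) i) = just refl
  is-0𝔾 _                 = nothing

infixl 6 _⊝_
_⊝_ : 𝔾 → 𝔾 → 𝔾
x ⊝ y = x ⊕ ⊖ y

conj : 𝔾 → 𝔾
conj (a + b i) = a + (- b) i

conj-⊗ : ∀ x y → conj (x ⊗ y) ≡ conj x ⊗ conj y
conj-⊗ (a + b i) (c + d i) = cong₂ _+_i (re-part a b c d) (im-part a b c d)
  where
  re-part : ∀ a b c d → a · c - b · d ≡ a · c - (- b) · (- d)
  re-part = solve-∀
  im-part : ∀ a b c d → - (a · d + b · c) ≡ a · (- d) + (- b) · c
  im-part = solve-∀

ρ : 𝔾 → 𝔾
ρ (a + b i) = (- b) + a i

ρ≡i⊗ : ∀ z → ρ z ≡ i𝔾 ⊗ z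
ρ≡i⊗ (a + b i) = cong₂ _+_i (re-part a b) (im-part a b)
  where
  re-part : ∀ a b → - b ≡ + 0 · a - + 1 · b
  re-part = solve-∀
  im-part : ∀ a b → a ≡ + 0 · b + + 1 · a
  im-part = solve-∀

ρ-Invariant : (𝔾 → Set) → Set
ρ-Invariant Q = ∀ z → Q z → Q (ρ z)

module _ {Q : 𝔾 → Set} where

  unit-invariant : ρ-Invariant Q → ∀ j z → Q z → Q (i𝔾 ^𝔾 j ⊗ z)
  unit-invariant Qρ zero    z q = subst Q (sym (⊗-identityˡ z)) q
  unit-invariant Qρ (suc j) z q =
    subst Q (trans (ρ≡i⊗ _) (sym (⊗-assoc i𝔾 (i𝔾 ^𝔾 j) z))) (Qρ _ (unit-invariant Qρ j z q))

  unit-invariant⁻¹ : (∀ z → Q (ρ z) → Q z) → ∀ j z → Q (i𝔾 ^𝔾 j ⊗ z) → Q z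
  unit-invariant⁻¹ Qρ⁻¹ zero    z q = subst Q (⊗-identityˡ z) q
  unit-invariant⁻¹ Qρ⁻¹ (suc j) z q = Qρ⁻¹ z (unit-invariant⁻¹ Qρ⁻¹ j (ρ z) (subst Q eq q))
    where
    swap : ∀ u z → (i𝔾 ⊗ u) ⊗ z ≡ u ⊗ (i𝔾 ⊗ z)
    swap = RingSolver.solve-∀ 𝔾-ring
    eq : i𝔾 ^𝔾 suc j ⊗ z ≡ i𝔾 ^𝔾 j ⊗ ρ z
    eq = trans (swap (i𝔾 ^𝔾 j) z) (cong (i𝔾 ^𝔾 j ⊗_) (sym (ρ≡i⊗ z)))

^𝔾-+ : ∀ x m n → x ^𝔾 (m ℕ.+ n) ≡ x ^𝔾 m ⊗ x ^𝔾 n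
^𝔾-+ x zero    n = sym (⊗-identityˡ _)
^𝔾-+ x (suc m) n = trans (cong (x ⊗_) (^𝔾-+ x m n)) (sym (⊗-assoc x _ _))

conj-i^ : ∀ j → conj (i𝔾 ^𝔾 j) ≡ i𝔾 ^𝔾 (3 * j)
conj-i^ zero    = refl
conj-i^ (suc j) = begin
  conj (i𝔾 ⊗ i𝔾 ^𝔾 j)         ≡⟨ conj-⊗ i𝔾 (i𝔾 ^𝔾 j) ⟩
  conj i𝔾 ⊗ conj (i𝔾 ^𝔾 j)    ≡⟨ cong (conj i𝔾 ⊗_) (conj-i^ j) ⟩
  conj i𝔾 ⊗ i𝔾 ^𝔾 (3 * j)     ≡⟨ conj-i (i𝔾 ^𝔾 (3 * j)) ⟩
  i𝔾 ^𝔾 (3 ℕ.+ 3 * j)         ≡⟨ cong (i𝔾 ^𝔾_) (sym (ℕₚ.*-suc 3 j)) ⟩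
  i𝔾 ^𝔾 (3 * suc j)           ∎
  where
  open ≡-Reasoning
  conj-i : ∀ v → conj i𝔾 ⊗ v ≡ i𝔾 ⊗ (i𝔾 ⊗ (i𝔾 ⊗ v))
  conj-i = RingSolver.solve-∀ 𝔾-ring

i^⊗i^3*≡1 : ∀ j → i𝔾 ^𝔾 j ⊗ i𝔾 ^𝔾 (3 * j) ≡ 1𝔾
i^⊗i^3*≡1 zero    = refl
i^⊗i^3*≡1 (suc j) = begin
  i𝔾 ^𝔾 suc j ⊗ i𝔾 ^𝔾 (3 * suc j)       ≡⟨ cong (λ n → i𝔾 ^𝔾 suc j ⊗ i𝔾 ^𝔾 n) (ℕₚ.*-suc 3 j) ⟩
  (i𝔾 ⊗ u) ⊗ (i𝔾 ⊗ (i𝔾 ⊗ (i𝔾 ⊗ v)))   ≡⟨ i⁴ u v ⟩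
  u ⊗ v                                   ≡⟨ i^⊗i^3*≡1 j ⟩
  1𝔾                                      ∎
  where
  open ≡-Reasoning
  u = i𝔾 ^𝔾 j
  v = i𝔾 ^𝔾 (3 * j)
  i⁴ : ∀ u v → (i𝔾 ⊗ u) ⊗ (i𝔾 ⊗ (i𝔾 ⊗ (i𝔾 ⊗ v))) ≡ u ⊗ v
  i⁴ = RingSolver.solve-∀ 𝔾-ring

1+i⊗-injective : ∀ {x y} → 1+i ⊗ x ≡ 1+i ⊗ y → x ≡ y
1+i⊗-injective {x} {y} eq = double-injective (begin
  x ⊕ x                    ≡⟨ halve x ⟩
  (1𝔾 ⊝ i𝔾) ⊗ (1+i ⊗ x)    ≡⟨ cong ((1𝔾 ⊝ i𝔾) ⊗_) eq ⟩
  (1𝔾 ⊝ i𝔾) ⊗ (1+i ⊗ y)    ≡⟨ sym (halve y) ⟩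
  y ⊕ y                    ∎)
  where
  open ≡-Reasoning
  halve : ∀ x → x ⊕ x ≡ (1𝔾 ⊝ i𝔾) ⊗ (1+i ⊗ x)
  halve = RingSolver.solve-∀ 𝔾-ring
  twice : ∀ a → + 2 · a ≡ a + a
  twice = solve-∀
  half : ∀ {a c} → a + a ≡ c + c → a ≡ c
  half {a} {c} eq = ℤₚ.*-cancelˡ-≡ (+ 2) a c (trans (twice a) (trans eq (sym (twice c))))
  double-injective : ∀ {x y} → x ⊕ x ≡ y ⊕ y → x ≡ y
  double-injective {a + b i} {c + d i} eq = cong₂ _+_i (half (cong re eq)) (half (cong im eq))

-- Odd y means that 1 + i does not divide y (see odd-or-even).
Odd : 𝔾 → Set
Odd y = ∃[ q ] re y + im y ≡ + 1 + q · + 2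

odd≢even : ∀ q q′ → + 1 + q · + 2 ≢ q′ · + 2
odd≢even q q′ eq = contradiction (ℕₚ.m*n≡1⇒n≡1 ∣ q′ - q ∣ 2 ∣twice∣≡1) λ ()
  where
  open ≡-Reasoning
  twice≡1 : (q′ - q) · + 2 ≡ + 1
  twice≡1 = begin
    (q′ - q) · + 2             ≡⟨ solve (q ∷ q′ ∷ []) ⟩
    q′ · + 2 - q · + 2         ≡⟨ cong (_- q · + 2) (sym eq) ⟩
    (+ 1 + q · + 2) - q · + 2  ≡⟨ solve (q ∷ []) ⟩
    + 1                        ∎
  ∣twice∣≡1 : ∣ q′ - q ∣ ℕ.* 2 ≡ 1
  ∣twice∣≡1 = trans (sym (ℤₚ.abs-* (q′ - q) (+ 2))) (cong ∣_∣ twice≡1)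

even-split : ∀ a b q → a + b ≡ + 0 + q · + 2 → a + b i ≡ 1+i ⊗ (q + (q - a) i)
even-split a b q a+b≡ = cong₂ _+_i (solve (a ∷ q ∷ [])) (begin
  b                          ≡⟨ solve (a ∷ b ∷ []) ⟩
  (a + b) - a                ≡⟨ cong (_- a) a+b≡ ⟩
  (+ 0 + q · + 2) - a        ≡⟨ solve (a ∷ q ∷ []) ⟩
  + 1 · (q - a) + + 1 · q    ∎)
  where open ≡-Reasoning

odd-or-even : ∀ y → Odd y ⊎ ∃[ z ] y ≡ 1+i ⊗ z
odd-or-even (a + b i)
  with (a + b) ℤ.%ℕ 2 | ℤ.n%ℕd<d (a + b) 2 | ℤ.a≡a%ℕn+[a/ℕn]*n (a + b) 2
... | 0           | _                  | a+b≡ =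
  let q = (a + b) ℤ./ℕ 2 in inj₂ (q + (q - a) i , even-split a b q a+b≡)
... | 1           | _                  | a+b≡ = inj₁ ((a + b) ℤ./ℕ 2 , a+b≡)
... | suc (suc _) | ℕ.s≤s (ℕ.s≤s ()) | _

¬Odd-1+i⊗ : ∀ z → ¬ Odd (1+i ⊗ z)
¬Odd-1+i⊗ (p + r i) (q , eq) = odd≢even q p (trans (sym eq) (sum≡ p r))
  where
  sum≡ : ∀ p r → (+ 1 · p - + 1 · r) + (+ 1 · r + + 1 · p) ≡ p · + 2
  sum≡ = solve-∀

Odd-⊝-1+i⊗ : ∀ y z → Odd y → Odd (y ⊝ 1+i ⊗ z)
Odd-⊝-1+i⊗ (a + b i) (p + r i) (q , eq) = q - p , (begin
  (a + - (+ 1 · p - + 1 · r)) + (b + - (+ 1 · r + + 1 · p))  ≡⟨ solve (a ∷ b ∷ p ∷ r ∷ []) ⟩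
  (a + b) - p · + 2                                          ≡⟨ cong (_- p · + 2) eq ⟩
  (+ 1 + q · + 2) - p · + 2                                  ≡⟨ solve (p ∷ q ∷ []) ⟩
  + 1 + (q - p) · + 2                                        ∎)
  where open ≡-Reasoning

Odd-ρ : ρ-Invariant Odd
Odd-ρ y odd = subst Odd (sym (trans (ρ≡i⊗ y) (rotation y))) (Odd-⊝-1+i⊗ y (⊖ (i𝔾 ⊗ y)) odd)
  where
  rotation : ∀ y → i𝔾 ⊗ y ≡ y ⊝ 1+i ⊗ ⊖ (i𝔾 ⊗ y)
  rotation = RingSolver.solve-∀ 𝔾-ring

-- x ≤ y is certified by writing y - x as a combination of terms known to be non-negative;
-- the remaining identity is left to the ring solver.
infixl 6 _⊞_
infixl 7 _⊠_
data NonNeg : ℤ → Set where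
  gap : ∀ {x y} → x ≤ y → NonNeg (y - x)
  lit : ∀ n → NonNeg (+ n)
  _⊞_ : ∀ {x y} → NonNeg x → NonNeg y → NonNeg (x + y)
  _⊠_ : ∀ {x y} → NonNeg x → NonNeg y → NonNeg (x · y)

·-nonNeg : ∀ {x y} → + 0 ≤ x → + 0 ≤ y → + 0 ≤ x · y
·-nonNeg {+ m} {+ n} _ _ = subst (+ 0 ≤_) (ℤₚ.pos-* m n) (ℤ.+≤+ ℕ.z≤n)

nonNeg : ∀ {x} → NonNeg x → + 0 ≤ x
nonNeg (gap x≤y) = ℤₚ.i≤j⇒0≤j-i x≤y
nonNeg (lit n)   = ℤ.+≤+ ℕ.z≤n
nonNeg (p ⊞ q)   = ℤₚ.+-mono-≤ (nonNeg p) (nonNeg q)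
nonNeg (p ⊠ q)   = ·-nonNeg (nonNeg p) (nonNeg q)

≤-by : ∀ {x e y} → NonNeg e → x + e ≡ y → x ≤ y
≤-by {x} {e} {y} p eq =
  subst (_≤ y) (ℤₚ.+-identityʳ x) (subst (x + + 0 ≤_) eq (ℤₚ.+-monoʳ-≤ x (nonNeg p)))

<⇒1+≤ : ∀ {x y} → x < y → + 1 + x ≤ y
<⇒1+≤ = ℤₚ.i<j⇒suc[i]≤j

1≰0 : ¬ (+ 1 ≤ + 0)
1≰0 (ℤ.+≤+ ())

half-≤ : ∀ x y → + 2 · x ≤ + 2 · y + + 1 → x ≤ y
half-≤ x y 2x≤2y+1 = decide (x ≤? y)
  where
  decide : Dec (x ≤ y) → x ≤ y
  decide (yes x≤y) = x≤y
  decide (no x≰y)  = ⊥-elim (1≰0 (≤-by (gap y<x ⊞ gap y<x ⊞ gap 2x≤2y+1) (solve (x ∷ y ∷ []))))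
    where
    y<x : + 1 + y ≤ x
    y<x = <⇒1+≤ (ℤₚ.≰⇒> x≰y)

·-cancel-≤ : ∀ d {x y} → + 1 ≤ d → d · x ≤ d · y → x ≤ y
·-cancel-≤ (+ suc n) {x} {y} _ = ℤₚ.*-cancelˡ-≤-pos x y (+ suc n)
·-cancel-≤ (+ zero)   (ℤ.+≤+ ())
·-cancel-≤ ℤ.-[1+ n ] ()

infix 4 ∣_∣≤_
∣_∣≤_ : ℤ → ℤ → Set
∣ x ∣≤ w = - w ≤ x × x ≤ w

∣_∣≤?_ : ∀ x w → Dec (∣ x ∣≤ w)
∣ x ∣≤? w = (- w ≤? x) ×-dec (x ≤? w)

¬∣∣≤ : ∀ {x w} → ¬ ∣ x ∣≤ w → + 1 + w ≤ x ⊎ + 1 + w ≤ - x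
¬∣∣≤ {x} {w} ¬x≤ = by-lower (- w ≤? x)
  where
  by-lower : Dec (- w ≤ x) → + 1 + w ≤ x ⊎ + 1 + w ≤ - x
  by-lower (yes -w≤x) = inj₁ (<⇒1+≤ (ℤₚ.≰⇒> (λ x≤w → ¬x≤ (-w≤x , x≤w))))
  by-lower (no -w≰x)  = inj₂ (≤-by (gap (<⇒1+≤ (ℤₚ.≰⇒> -w≰x))) (solve (x ∷ w ∷ [])))

∣∣≤-from-abs : ∀ x w → + ∣ x ∣ ≤ w → ∣ x ∣≤ w
∣∣≤-from-abs x w = bounds x (+ ∣ x ∣) w (x≤∣x∣ x) (-x≤∣x∣ x)
  where
  bounds : ∀ x n w → x ≤ n → - x ≤ n → n ≤ w → ∣ x ∣≤ w
  bounds x n w x≤n -x≤n n≤w =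
    ≤-by (gap -x≤n ⊞ gap n≤w) (solve vs) , ≤-by (gap x≤n ⊞ gap n≤w) (solve vs)
    where vs = x ∷ n ∷ w ∷ []
  x≤∣x∣ : ∀ x → x ≤ + ∣ x ∣
  x≤∣x∣ (+ n)      = ℤₚ.≤-refl
  x≤∣x∣ ℤ.-[1+ n ] = ℤ.-≤+
  -x≤∣x∣ : ∀ x → - x ≤ + ∣ x ∣
  -x≤∣x∣ (+ n)      = ℤₚ.neg-≤-pos
  -x≤∣x∣ ℤ.-[1+ n ] = ℤₚ.≤-refl

square-nonNeg : ∀ x → + 0 ≤ x · x
square-nonNeg x = by-sign (ℤₚ.≤-total (+ 0) x)
  where
  by-sign : + 0 ≤ x ⊎ x ≤ + 0 → + 0 ≤ x · x
  by-sign (inj₁ 0≤x) = ·-nonNeg 0≤x 0≤x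
  by-sign (inj₂ x≤0) = ≤-by (gap x≤0 ⊠ gap x≤0) (solve (x ∷ []))

square-≤ : ∀ x w → ∣ x ∣≤ w → x · x ≤ w · w
square-≤ x w (x₁ , x₂) = ≤-by (gap x₂ ⊠ gap x₁) (solve (x ∷ w ∷ []))

square-≥ : ∀ w x → + 0 ≤ w → w ≤ x → w · w ≤ x · x
square-≥ w x 0≤w w≤x = ≤-by (gap w≤x ⊠ (gap w≤x ⊞ gap 0≤w ⊞ gap 0≤w)) (solve (w ∷ x ∷ []))

2^ : ℕ → ℤ
2^ k = + (2 ℕ.^ k)

1≤2^ : ∀ k → + 1 ≤ 2^ k
1≤2^ k = ℤ.+≤+ (ℕₚ.m^n>0 2 k)

2^-suc : ∀ k → 2^ (suc k) ≡ + 2 · 2^ k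
2^-suc k = ℤₚ.pos-* 2 (2 ℕ.^ k)

-- Octagons and the sets Motzkin m

-- Lemmas about octagons are proved on coordinates (Octagon′), where the ring solver sees
-- every bound as a polynomial in variables.
Octagon′ : ℤ → ℤ → ℤ → ℤ → Set
Octagon′ w s a b = ∣ a ∣≤ w × ∣ b ∣≤ w × ∣ a + b ∣≤ s × ∣ a - b ∣≤ s

Octagon : ℤ → ℤ → 𝔾 → Set
Octagon w s y = Octagon′ w s (re y) (im y)

Octagon? : ∀ w s y → Dec (Octagon w s y)
Octagon? w s y =
  ∣ re y ∣≤? w ×-dec ∣ im y ∣≤? w ×-dec ∣ re y + im y ∣≤? s ×-dec ∣ re y - im y ∣≤? s

Octagon-0 : ∀ {w s} → + 0 ≤ w → + 0 ≤ s → Octagon w s 0𝔾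
Octagon-0 {w} {s} 0≤w 0≤s =
  (≤-by (gap 0≤w) (solve vs) , 0≤w) , (≤-by (gap 0≤w) (solve vs) , 0≤w) ,
  (≤-by (gap 0≤s) (solve vs) , 0≤s) , (≤-by (gap 0≤s) (solve vs) , 0≤s)
  where vs = w ∷ s ∷ []

Octagon′-ρ : ∀ {w s a b} → Octagon′ w s a b → Octagon′ w s (- b) a
Octagon′-ρ {w} {s} {a} {b} ((a₁ , a₂) , (b₁ , b₂) , (s₁ , s₂) , (d₁ , d₂)) =
  (≤-by (gap b₂) (solve vs) , ≤-by (gap b₁) (solve vs)) , (a₁ , a₂) ,
  (≤-by (gap d₁) (solve vs) , ≤-by (gap d₂) (solve vs)) , (≤-by (gap s₂) (solve vs) , ≤-by (gap s₁) (solve vs))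
  where vs = w ∷ s ∷ a ∷ b ∷ []

Octagon′-ρ⁻¹ : ∀ {w s a b} → Octagon′ w s (- b) a → Octagon′ w s a b
Octagon′-ρ⁻¹ {w} {s} {a} {b} ((b₁ , b₂) , (a₁ , a₂) , (d₁ , d₂) , (s₁ , s₂)) =
  (a₁ , a₂) , (≤-by (gap b₂) (solve vs) , ≤-by (gap b₁) (solve vs)) ,
  (≤-by (gap s₂) (solve vs) , ≤-by (gap s₁) (solve vs)) , (≤-by (gap d₁) (solve vs) , ≤-by (gap d₂) (solve vs))
  where vs = w ∷ s ∷ a ∷ b ∷ []

Octagon′-1+i⊗ : ∀ {w s p r} → Octagon′ w s p r →
                Octagon′ (s + + 1) (+ 2 · w + + 1) (+ 1 · p - + 1 · r) (+ 1 · r + + 1 · p)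
Octagon′-1+i⊗ {w} {s} {p} {r} ((p₁ , p₂) , (r₁ , r₂) , (s₁ , s₂) , (d₁ , d₂)) =
  (≤-by (gap d₁ ⊞ lit 1) (solve vs) , ≤-by (gap d₂ ⊞ lit 1) (solve vs)) ,
  (≤-by (gap s₁ ⊞ lit 1) (solve vs) , ≤-by (gap s₂ ⊞ lit 1) (solve vs)) ,
  (≤-by (gap p₁ ⊞ gap p₁ ⊞ lit 1) (solve vs) , ≤-by (gap p₂ ⊞ gap p₂ ⊞ lit 1) (solve vs)) ,
  (≤-by (gap r₂ ⊞ gap r₂ ⊞ lit 1) (solve vs) , ≤-by (gap r₁ ⊞ gap r₁ ⊞ lit 1) (solve vs))
  where vs = w ∷ s ∷ p ∷ r ∷ []

Octagon-ρ : ∀ {w s} → ρ-Invariant (Octagon w s)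
Octagon-ρ (a + b i) = Octagon′-ρ

Octagon-ρ⁻¹ : ∀ {w s} z → Octagon w s (ρ z) → Octagon w s z
Octagon-ρ⁻¹ (a + b i) = Octagon′-ρ⁻¹

Octagon-1+i⊗ : ∀ {w s} z → Octagon w s z → Octagon (s + + 1) (+ 2 · w + + 1) (1+i ⊗ z)
Octagon-1+i⊗ (p + r i) = Octagon′-1+i⊗

-- Half-widths of the octagons of the successive levels; the recursion is the bound of Octagon-1+i⊗.
width span : ℕ → ℤ
width zero    = + 0
width (suc m) = span m + + 1
span zero     = + 0
span (suc m)  = + 2 · width m + + 1

width-span-nonNeg : ∀ m → + 0 ≤ width m × + 0 ≤ span m
width-span-nonNeg zero    = ℤ.+≤+ ℕ.z≤n , ℤ.+≤+ ℕ.z≤n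
width-span-nonNeg (suc m) = step (width-span-nonNeg m)
  where
  step : ∀ {w s} → + 0 ≤ w × + 0 ≤ s → + 0 ≤ s + + 1 × + 0 ≤ + 2 · w + + 1
  step {w} {s} (0≤w , 0≤s) =
    ≤-by (gap 0≤s ⊞ lit 1) (solve (s ∷ [])) , ≤-by (gap 0≤w ⊞ gap 0≤w ⊞ lit 1) (solve (w ∷ []))

width≤span+1 : ∀ m → width m ≤ span m + + 1
width≤span+1 zero          = ℤ.+≤+ ℕ.z≤n
width≤span+1 (suc zero)    = ℤ.+≤+ (ℕ.s≤s ℕ.z≤n)
width≤span+1 (suc (suc m)) = step {width m} {span m} (width≤span+1 m)
  where
  step : ∀ {w s} → w ≤ s + + 1 → (+ 2 · w + + 1) + + 1 ≤ (+ 2 · (s + + 1) + + 1) + + 1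
  step {w} {s} w≤s+1 = ≤-by (gap w≤s+1 ⊞ gap w≤s+1) (solve (w ∷ s ∷ []))

span≤2width+2 : ∀ m → span m ≤ + 2 · width m + + 2
span≤2width+2 zero    = ℤ.+≤+ ℕ.z≤n
span≤2width+2 (suc m) = step {width m} {span m} (width≤span+1 m)
  where
  step : ∀ {w s} → w ≤ s + + 1 → + 2 · w + + 1 ≤ + 2 · (s + + 1) + + 2
  step {w} {s} w≤s+1 = ≤-by (gap w≤s+1 ⊞ gap w≤s+1 ⊞ lit 1) (solve (w ∷ s ∷ []))

width-span-odd : ∀ k → width (suc (2 * k)) ≡ + 3 · 2^ k - + 2 × span (suc (2 * k)) ≡ + 4 · 2^ k - + 3
width-span-odd zero    = refl , refl
width-span-odd (suc k) with width-span-odd k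
... | w≡ , s≡ = (begin
  width (suc (2 * suc k))                     ≡⟨ cong (width ∘ suc) (ℕₚ.*-suc 2 k) ⟩
  + 2 · width (suc (2 * k)) + + 1 + + 1       ≡⟨ cong (λ w → + 2 · w + + 1 + + 1) w≡ ⟩
  + 2 · (+ 3 · 2^ k - + 2) + + 1 + + 1         ≡⟨ grow-width (2^ k) ⟩
  + 3 · (+ 2 · 2^ k) - + 2                     ≡⟨ cong (λ D → + 3 · D - + 2) (sym (2^-suc k)) ⟩
  + 3 · 2^ (suc k) - + 2                       ∎) , (begin
  span (suc (2 * suc k))                      ≡⟨ cong (span ∘ suc) (ℕₚ.*-suc 2 k) ⟩
  + 2 · (span (suc (2 * k)) + + 1) + + 1      ≡⟨ cong (λ s → + 2 · (s + + 1) + + 1) s≡ ⟩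
  + 2 · (+ 4 · 2^ k - + 3 + + 1) + + 1         ≡⟨ grow-span (2^ k) ⟩
  + 4 · (+ 2 · 2^ k) - + 3                     ≡⟨ cong (λ D → + 4 · D - + 3) (sym (2^-suc k)) ⟩
  + 4 · 2^ (suc k) - + 3                       ∎)
  where
  open ≡-Reasoning
  grow-width : ∀ D → + 2 · (+ 3 · D - + 2) + + 1 + + 1 ≡ + 3 · (+ 2 · D) - + 2
  grow-width = solve-∀
  grow-span : ∀ D → + 2 · (+ 4 · D - + 3 + + 1) + + 1 ≡ + 4 · (+ 2 · D) - + 3
  grow-span = solve-∀

OddOctagon : ℕ → 𝔾 → Set
OddOctagon m y = Odd y × Octagon (width m) (span m) y

OddOctagon-ρ : ∀ {m} → ρ-Invariant (OddOctagon m)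
OddOctagon-ρ y (odd , oct) = Odd-ρ y odd , Octagon-ρ y oct

-- Motzkin m contains every x with φ(x) < m (motzkin-lower), and each of its members has a
-- (1 + i)-ary expansion of length m (expansion-of).
Motzkin : ℕ → 𝔾 → Set
Motzkin zero    y = ⊥
Motzkin (suc m) y = OddOctagon (suc m) y ⊎ ∃[ z ] y ≡ 1+i ⊗ z × Motzkin m z

Motzkin⊆Octagon : ∀ m y → Motzkin m y → Octagon (width m) (span m) y
Motzkin⊆Octagon zero    y ()
Motzkin⊆Octagon (suc m) y (inj₁ (_ , oct))       = oct
Motzkin⊆Octagon (suc m) _ (inj₂ (z , refl , z∈)) = Octagon-1+i⊗ z (Motzkin⊆Octagon m z z∈)

Motzkin? : ∀ m y → Dec (Motzkin m y)
Motzkin? zero y = no λ ()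
Motzkin? (suc m) y with odd-or-even y
... | inj₁ odd with Octagon? (width (suc m)) (span (suc m)) y
...   | yes oct = yes (inj₁ (odd , oct))
...   | no ¬oct = no λ { (inj₁ (_ , oct)) → ¬oct oct ; (inj₂ (z , refl , _)) → ¬Odd-1+i⊗ z odd }
Motzkin? (suc m) y | inj₂ (z , y≡) with Motzkin? m z
...   | yes z∈ = yes (inj₂ (z , y≡ , z∈))
...   | no z∉  = no λ
  { (inj₁ (odd , _))        → ¬Odd-1+i⊗ z (subst Odd y≡ odd)
  ; (inj₂ (z′ , y≡′ , z′∈)) → z∉ (subst (Motzkin m) (1+i⊗-injective (trans (sym y≡′) y≡)) z′∈)
  }

RightSector : 𝔾 → Set
RightSector z = ∣ im z ∣≤ re z

-- y lies within an angle π/4 of the direction d.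
Sector : 𝔾 → 𝔾 → Set
Sector d y = RightSector (y ⊗ conj d)

RightSector-scale : ∀ k w → RightSector w → RightSector (two^ k ⊗ w)
RightSector-scale k (p + q i) = scale (2^ k) p q (ℤₚ.≤-trans (ℤ.+≤+ ℕ.z≤n) (1≤2^ k))
  where
  scale : ∀ D p q → + 0 ≤ D → ∣ q ∣≤ p → ∣ D · q + + 0 · p ∣≤ D · p - + 0 · q
  scale D p q 0≤D (q₁ , q₂) = ≤-by (gap 0≤D ⊠ gap q₁) (solve vs) , ≤-by (gap 0≤D ⊠ gap q₂) (solve vs)
    where vs = D ∷ p ∷ q ∷ []

RightSector-unscale : ∀ k w → RightSector (two^ k ⊗ w) → RightSector w
RightSector-unscale k (p + q i) (q₁ , q₂) = unscale (2^ k) p q (1≤2^ k) q₁ q₂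
  where
  unscale : ∀ D p q → + 1 ≤ D → - (D · p - + 0 · q) ≤ D · q + + 0 · p →
            D · q + + 0 · p ≤ D · p - + 0 · q → ∣ q ∣≤ p
  unscale D p q 1≤D q₁ q₂ =
    ·-cancel-≤ D 1≤D (subst₂ _≤_ (-re≡ D p q) (im≡ D p q) q₁) ,
    ·-cancel-≤ D 1≤D (subst₂ _≤_ (im≡ D p q) (re≡ D p q) q₂)
    where
    -re≡ : ∀ D p q → - (D · p - + 0 · q) ≡ D · (- p)
    -re≡ = solve-∀
    re≡ : ∀ D p q → D · p - + 0 · q ≡ D · p
    re≡ = solve-∀
    im≡ : ∀ D p q → D · q + + 0 · p ≡ D · q
    im≡ = solve-∀

sector-product : ∀ u d y → y ⊗ conj (u ⊗ d) ≡ (conj u ⊗ y) ⊗ conj d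
sector-product u d y = trans (cong (y ⊗_) (conj-⊗ u d)) (reassociate y (conj u) (conj d))
  where
  reassociate : ∀ y u′ d′ → y ⊗ (u′ ⊗ d′) ≡ (u′ ⊗ y) ⊗ d′
  reassociate = RingSolver.solve-∀ 𝔾-ring

Sector-⊗ : ∀ u d y → Sector (u ⊗ d) y → Sector d (conj u ⊗ y)
Sector-⊗ u d y = subst RightSector (sector-product u d y)

scale-product : ∀ k d y → y ⊗ conj (two^ k ⊗ d) ≡ two^ k ⊗ (y ⊗ conj d)
scale-product k d y = trans (sector-product (two^ k) d y) (reassociate (two^ k) y (conj d))
  where
  reassociate : ∀ D y d′ → (D ⊗ y) ⊗ d′ ≡ D ⊗ (y ⊗ d′)
  reassociate = RingSolver.solve-∀ 𝔾-ring

Sector-scale : ∀ k d y → Sector d y → Sector (two^ k ⊗ d) y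
Sector-scale k d y sec = subst RightSector (sym (scale-product k d y)) (RightSector-scale k _ sec)

Sector-unscale : ∀ k d y → Sector (two^ k ⊗ d) y → Sector d y
Sector-unscale k d y sec = RightSector-unscale k _ (subst RightSector (scale-product k d y) sec)

Sector-1+i⊗ : ∀ d y → Sector (1+i ⊗ d) (1+i ⊗ y) → Sector d y
Sector-1+i⊗ d y sec = RightSector-unscale 1 _ (subst RightSector eq sec)
  where
  product : ∀ y c → (1+i ⊗ y) ⊗ (conj 1+i ⊗ c) ≡ two^ 1 ⊗ (y ⊗ c)
  product = RingSolver.solve-∀ 𝔾-ring
  eq : (1+i ⊗ y) ⊗ conj (1+i ⊗ d) ≡ two^ 1 ⊗ (y ⊗ conj d)
  eq = trans (cong ((1+i ⊗ y) ⊗_) (conj-⊗ 1+i d)) (product y (conj d))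

quadrant : ∀ p q → ∣ q ∣≤ p ⊎ ∣ p ∣≤ - q ⊎ ∣ q ∣≤ - p ⊎ ∣ p ∣≤ q
quadrant p q with - p ≤? q | q ≤? p
... | yes -p≤q | yes q≤p = inj₁ (-p≤q , q≤p)
... | yes -p≤q | no q≰p  =
  inj₂ (inj₂ (inj₂ (≤-by (gap -p≤q) (solve vs) , ℤₚ.<⇒≤ (ℤₚ.≰⇒> q≰p))))
  where vs = p ∷ q ∷ []
... | no -p≰q  | yes q≤p =
  inj₂ (inj₁ (≤-by (gap q≤p) (solve vs) , ≤-by (gap (<⇒1+≤ (ℤₚ.≰⇒> -p≰q)) ⊞ lit 1) (solve vs)))
  where vs = p ∷ q ∷ []
... | no -p≰q  | no q≰p  =
  inj₂ (inj₂ (inj₁ (≤-by (gap (<⇒1+≤ (ℤₚ.≰⇒> q≰p)) ⊞ lit 1) (solve vs) , ℤₚ.<⇒≤ (ℤₚ.≰⇒> -p≰q))))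
  where vs = p ∷ q ∷ []

⊗conj-i¹ : ∀ w → w ⊗ conj (i𝔾 ^𝔾 1) ≡ ⊖ (ρ w)
⊗conj-i¹ w = trans (turn w) (cong ⊖_ (sym (ρ≡i⊗ w)))
  where
  turn : ∀ w → w ⊗ conj (i𝔾 ^𝔾 1) ≡ ⊖ (i𝔾 ⊗ w)
  turn = RingSolver.solve-∀ 𝔾-ring

⊗conj-i² : ∀ w → w ⊗ conj (i𝔾 ^𝔾 2) ≡ ⊖ w
⊗conj-i² = RingSolver.solve-∀ 𝔾-ring

⊗conj-i³ : ∀ w → w ⊗ conj (i𝔾 ^𝔾 3) ≡ ρ w
⊗conj-i³ w = trans (⊗-comm w i𝔾) (sym (ρ≡i⊗ w))

unit-sector-cover : ∀ w → ∃[ j ] Sector (i𝔾 ^𝔾 j) w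
unit-sector-cover (p + q i) with quadrant p q
... | inj₁ h               = 0 , subst RightSector (sym (⊗-identityʳ _)) h
... | inj₂ (inj₁ h)        = 3 , subst RightSector (sym (⊗conj-i³ (p + q i))) h
... | inj₂ (inj₂ (inj₁ h)) = 2 , subst RightSector (sym (⊗conj-i² (p + q i))) (negated h)
  where
  negated : ∣ q ∣≤ - p → ∣ - q ∣≤ - p
  negated (q₁ , q₂) = ≤-by (gap q₂) (solve (p ∷ q ∷ [])) , ≤-by (gap q₁) (solve (p ∷ q ∷ []))
... | inj₂ (inj₂ (inj₂ h)) = 1 , subst RightSector (sym (⊗conj-i¹ (p + q i))) (turned h)
  where
  turned : ∣ p ∣≤ q → ∣ - p ∣≤ - - q
  turned (p₁ , p₂) = ≤-by (gap p₂) (solve (p ∷ q ∷ [])) , ≤-by (gap p₁) (solve (p ∷ q ∷ []))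

sector-cover : ∀ d y → ∃[ j ] Sector (i𝔾 ^𝔾 j ⊗ d) y
sector-cover d y with unit-sector-cover (y ⊗ conj d)
... | j , sec = j , subst RightSector (sym (product (i𝔾 ^𝔾 j))) sec
  where
  regroup : ∀ y u′ d′ → y ⊗ (u′ ⊗ d′) ≡ (y ⊗ d′) ⊗ u′
  regroup = RingSolver.solve-∀ 𝔾-ring
  product : ∀ u → y ⊗ conj (u ⊗ d) ≡ (y ⊗ conj d) ⊗ conj u
  product u = trans (cong (y ⊗_) (conj-⊗ u d)) (regroup y (conj u) (conj d))

sector-axial : ∀ k a b → Sector (two^ k) (a + b i) → ∣ b ∣≤ a
sector-axial k a b sec = subst RightSector (⊗-identityʳ (a + b i)) (Sector-unscale k 1𝔾 (a + b i) sec′)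
  where
  sec′ : Sector (two^ k ⊗ 1𝔾) (a + b i)
  sec′ = subst (λ d → Sector d (a + b i)) (sym (⊗-identityʳ (two^ k))) sec

sector-diagonal : ∀ k a b → Sector (1+i ⊗ two^ k) (a + b i) → + 0 ≤ a × + 0 ≤ b
sector-diagonal k a b sec = nonNeg-coordinates a b (proj₁ sec′) (proj₂ sec′)
  where
  sec′ : Sector 1+i (a + b i)
  sec′ = Sector-unscale k 1+i (a + b i) (subst (λ d → Sector d (a + b i)) (⊗-comm 1+i (two^ k)) sec)
  nonNeg-coordinates : ∀ a b → - (a · + 1 - b · - + 1) ≤ a · - + 1 + b · + 1 →
                       a · - + 1 + b · + 1 ≤ a · + 1 - b · - + 1 → + 0 ≤ a × + 0 ≤ b
  nonNeg-coordinates a b s₁ s₂ =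
    ≤-by (gap (half-≤ (- a) (+ 0) (≤-by (gap s₂ ⊞ lit 1) (solve vs)))) (solve vs) ,
    ≤-by (gap (half-≤ (- b) (+ 0) (≤-by (gap s₁ ⊞ lit 1) (solve vs)))) (solve vs)
    where vs = a ∷ b ∷ []

unit-sector-0 : ∀ a b → + ∣ b ∣ ≤ a → Sector (i𝔾 ^𝔾 0) (a + b i)
unit-sector-0 a b h = subst RightSector (sym (⊗-identityʳ (a + b i))) (∣∣≤-from-abs b a h)

unit-sector-1 : ∀ a b → + ∣ a ∣ ≤ b → Sector (i𝔾 ^𝔾 1) (a + b i)
unit-sector-1 a b h = subst RightSector (sym (⊗conj-i¹ (a + b i))) (∣∣≤-from-abs (- a) (- - b) h′)
  where
  h′ : + ∣ - a ∣ ≤ - - b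
  h′ = subst₂ _≤_ (cong +_ (sym (ℤₚ.∣-i∣≡∣i∣ a))) (sym (ℤₚ.neg-involutive b)) h

unit-sector-2 : ∀ a b → + ∣ b ∣ ≤ - a → Sector (i𝔾 ^𝔾 2) (a + b i)
unit-sector-2 a b h = subst RightSector (sym (⊗conj-i² (a + b i))) (∣∣≤-from-abs (- b) (- a) h′)
  where
  h′ : + ∣ - b ∣ ≤ - a
  h′ = subst (_≤ - a) (cong +_ (sym (ℤₚ.∣-i∣≡∣i∣ b))) h

unit-sector-3 : ∀ a b → + ∣ a ∣ ≤ - b → Sector (i𝔾 ^𝔾 3) (a + b i)
unit-sector-3 a b h = subst RightSector (sym (⊗conj-i³ (a + b i))) (∣∣≤-from-abs a (- b) h)

-- The leading digit

-- Rotating y back by the conjugate unit reduces the sector around iʲ d to the sector around d.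
rotate-direction : ∀ {Q R : 𝔾 → Set} d → ρ-Invariant Q → ρ-Invariant R →
                   (∀ y → Q y → Sector d y → R (y ⊝ d)) →
                   ∀ j y → Q y → Sector (i𝔾 ^𝔾 j ⊗ d) y → R (y ⊝ i𝔾 ^𝔾 j ⊗ d)
rotate-direction {Q} {R} d Qρ Rρ H j y Qy sec =
  subst R back (unit-invariant Rρ j _ (H (v ⊗ y) (unit-invariant Qρ (3 * j) y Qy) sec′))
  where
  open ≡-Reasoning
  u = i𝔾 ^𝔾 j
  v = i𝔾 ^𝔾 (3 * j)
  sec′ : Sector d (v ⊗ y)
  sec′ = subst (λ c → Sector d (c ⊗ y)) (conj-i^ j) (Sector-⊗ u d y sec)
  expand : ∀ u v y d → u ⊗ (v ⊗ y ⊝ d) ≡ (u ⊗ v) ⊗ y ⊝ u ⊗ d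
  expand = RingSolver.solve-∀ 𝔾-ring
  back : u ⊗ (v ⊗ y ⊝ d) ≡ y ⊝ u ⊗ d
  back = begin
    u ⊗ (v ⊗ y ⊝ d)        ≡⟨ expand u v y d ⟩
    (u ⊗ v) ⊗ y ⊝ u ⊗ d    ≡⟨ cong (λ c → c ⊗ y ⊝ u ⊗ d) (i^⊗i^3*≡1 j) ⟩
    1𝔾 ⊗ y ⊝ u ⊗ d         ≡⟨ cong (_⊝ u ⊗ d) (⊗-identityˡ y) ⟩
    y ⊝ u ⊗ d              ∎

two^-suc : ∀ k → two^ (suc k) ≡ two^ 1 ⊗ two^ k
two^-suc k = cong₂ _+_i (trans (2^-suc k) (re-part (2^ k))) (im-part (2^ k))
  where
  re-part : ∀ D → + 2 · D ≡ + 2 · D - + 0 · + 0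
  re-part = solve-∀
  im-part : ∀ D → + 0 ≡ + 2 · + 0 + + 0 · D
  im-part = solve-∀

1+i^-even : ∀ k → 1+i ^𝔾 (2 * k) ≡ i𝔾 ^𝔾 k ⊗ two^ k
1+i^-even zero    = refl
1+i^-even (suc k) = begin
  1+i ^𝔾 (2 * suc k)                   ≡⟨ cong (1+i ^𝔾_) (ℕₚ.*-suc 2 k) ⟩
  1+i ⊗ (1+i ⊗ 1+i ^𝔾 (2 * k))         ≡⟨ cong (λ x → 1+i ⊗ (1+i ⊗ x)) (1+i^-even k) ⟩
  1+i ⊗ (1+i ⊗ (i𝔾 ^𝔾 k ⊗ two^ k))     ≡⟨ square (i𝔾 ^𝔾 k) (two^ k) ⟩
  (i𝔾 ⊗ i𝔾 ^𝔾 k) ⊗ (two^ 1 ⊗ two^ k)   ≡⟨ cong ((i𝔾 ⊗ i𝔾 ^𝔾 k) ⊗_) (sym (two^-suc k)) ⟩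
  i𝔾 ^𝔾 suc k ⊗ two^ (suc k)           ∎
  where
  open ≡-Reasoning
  square : ∀ u t → 1+i ⊗ (1+i ⊗ (u ⊗ t)) ≡ (i𝔾 ⊗ u) ⊗ (two^ 1 ⊗ t)
  square = RingSolver.solve-∀ 𝔾-ring

1+i^-odd : ∀ k → 1+i ^𝔾 suc (2 * k) ≡ i𝔾 ^𝔾 k ⊗ (1+i ⊗ two^ k)
1+i^-odd k = trans (cong (1+i ⊗_) (1+i^-even k)) (swap (i𝔾 ^𝔾 k) (two^ k))
  where
  swap : ∀ u t → 1+i ⊗ (u ⊗ t) ≡ u ⊗ (1+i ⊗ t)
  swap = RingSolver.solve-∀ 𝔾-ring

diagonal-step′ : ∀ D W S a b c → + 1 ≤ D → W ≡ + 3 · D - + 2 → S ≡ + 4 · D - + 3 →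
                 a + b ≡ + 1 + c · + 2 → Octagon′ (S + + 1) (+ 2 · W + + 1) a b → + 0 ≤ a → + 0 ≤ b →
                 Octagon′ W S (a - D) (b - D)
diagonal-step′ D _ _ a b c 1≤D refl refl a+b≡ ((_ , a≤) , (_ , b≤) , (_ , a+b≤) , _) 0≤a 0≤b =
  (≤-by (gap 0≤a ⊞ gap 1≤D ⊞ gap 1≤D) (solve vs) , ≤-by (gap a≤) (solve vs)) ,
  (≤-by (gap 0≤b ⊞ gap 1≤D ⊞ gap 1≤D) (solve vs) , ≤-by (gap b≤) (solve vs)) ,
  (≤-by (gap ≥a+b ⊞ gap -c≤0 ⊞ gap -c≤0 ⊞ gap 1≤D ⊞ gap 1≤D) (solve vs) , ≤-by (gap a+b≤) (solve vs)) ,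
  (≤-by (gap c-a≤ ⊞ gap c-a≤ ⊞ gap a+b≤′) (solve vs) ,
   ≤-by (gap c-b≤ ⊞ gap c-b≤ ⊞ gap a+b≤′) (solve vs))
  where
  vs = D ∷ a ∷ b ∷ c ∷ []
  a+b≤′ : a + b ≤ + 1 + c · + 2
  a+b≤′ = ℤₚ.≤-reflexive a+b≡
  ≥a+b : + 1 + c · + 2 ≤ a + b
  ≥a+b = ℤₚ.≤-reflexive (sym a+b≡)
  -c≤0 : - c ≤ + 0
  -c≤0 = half-≤ (- c) (+ 0) (≤-by (gap 0≤a ⊞ gap 0≤b ⊞ gap a+b≤′) (solve vs))
  c-a≤ : c - a ≤ + 2 · D - + 2
  c-a≤ = half-≤ (c - a) _ (≤-by (gap b≤ ⊞ gap 0≤a ⊞ gap ≥a+b) (solve vs))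
  c-b≤ : c - b ≤ + 2 · D - + 2
  c-b≤ = half-≤ (c - b) _ (≤-by (gap a≤ ⊞ gap 0≤b ⊞ gap ≥a+b) (solve vs))

axial-step′ : ∀ D W S a b → + 1 ≤ D → W ≡ + 3 · D - + 2 → S ≡ + 4 · D - + 3 →
              Octagon′ (+ 2 · W + + 1 + + 1) (+ 2 · (S + + 1) + + 1) a b → ∣ b ∣≤ a →
              Octagon′ (S + + 1) (+ 2 · W + + 1) (a - + 2 · D) b
axial-step′ D _ _ a b 1≤D refl refl ((_ , a≤) , _ , (_ , a+b≤) , (_ , a-b≤)) (b₁ , b₂) =
  (≤-by (gap 0≤a ⊞ gap 1≤D ⊞ gap 1≤D) (solve vs) , ≤-by (gap a≤) (solve vs)) ,
  (≤-by (gap -b≤) (solve vs) , ≤-by (gap b≤) (solve vs)) ,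
  (≤-by (gap b₁ ⊞ gap 1≤D ⊞ gap 1≤D ⊞ gap 1≤D ⊞ gap 1≤D ⊞ lit 1) (solve vs) ,
   ≤-by (gap a+b≤) (solve vs)) ,
  (≤-by (gap b₂ ⊞ gap 1≤D ⊞ gap 1≤D ⊞ gap 1≤D ⊞ gap 1≤D ⊞ lit 1) (solve vs) ,
   ≤-by (gap a-b≤) (solve vs))
  where
  vs = D ∷ a ∷ b ∷ []
  0≤a : + 0 ≤ a
  0≤a = ≤-by (gap (half-≤ (- a) (+ 0) (≤-by (gap b₁ ⊞ gap b₂ ⊞ lit 1) (solve vs)))) (solve vs)
  -b≤ : - b ≤ + 4 · D - + 2
  -b≤ = half-≤ (- b) (+ 4 · D - + 2) (≤-by (gap a-b≤ ⊞ gap b₁) (solve vs))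
  b≤ : b ≤ + 4 · D - + 2
  b≤ = half-≤ b (+ 4 · D - + 2) (≤-by (gap a+b≤ ⊞ gap b₂) (solve vs))

base-step′ : ∀ a b c → a + b ≡ + 1 + c · + 2 → Octagon′ (+ 1) (+ 1) a b → ∣ b ∣≤ a →
             a ≡ + 1 × b ≡ + 0
base-step′ a b c a+b≡ ((_ , a≤1) , _ , (_ , a+b≤1) , (_ , a-b≤1)) (b₁ , b₂) =
  ℤₚ.≤-antisym a≤1 (≤-by (gap ≥a+b ⊞ gap b≤0 ⊞ gap -c≤0 ⊞ gap -c≤0) (solve vs)) ,
  ℤₚ.≤-antisym b≤0 (≤-by (gap -b≤0) (solve vs))
  where
  vs = a ∷ b ∷ c ∷ []
  a+b≤ : a + b ≤ + 1 + c · + 2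
  a+b≤ = ℤₚ.≤-reflexive a+b≡
  ≥a+b : + 1 + c · + 2 ≤ a + b
  ≥a+b = ℤₚ.≤-reflexive (sym a+b≡)
  c≤0 : c ≤ + 0
  c≤0 = half-≤ c (+ 0) (≤-by (gap a+b≤1 ⊞ gap ≥a+b ⊞ lit 1) (solve vs))
  -c≤0 : - c ≤ + 0
  -c≤0 = half-≤ (- c) (+ 0) (≤-by (gap a+b≤ ⊞ gap b₁) (solve vs))
  b≤0 : b ≤ + 0
  b≤0 = half-≤ b (+ 0) (≤-by (gap b₂ ⊞ gap a+b≤ ⊞ gap c≤0 ⊞ gap c≤0) (solve vs))
  -b≤0 : - b ≤ + 0
  -b≤0 = half-≤ (- b) (+ 0) (≤-by (gap a-b≤1 ⊞ gap ≥a+b ⊞ gap -c≤0 ⊞ gap -c≤0 ⊞ lit 1) (solve vs))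

diagonal-step : ∀ k y → OddOctagon (suc (suc (2 * k))) y → Sector (1+i ⊗ two^ k) y →
                OddOctagon (suc (2 * k)) (y ⊝ 1+i ⊗ two^ k)
diagonal-step k (a + b i) ((c , a+b≡) , oct) sec =
  Odd-⊝-1+i⊗ (a + b i) (two^ k) (c , a+b≡) ,
  subst (Octagon (width (suc (2 * k))) (span (suc (2 * k)))) (sym difference)
        (diagonal-step′ (2^ k) (width (suc (2 * k))) (span (suc (2 * k))) a b c (1≤2^ k)
                        (proj₁ (width-span-odd k)) (proj₂ (width-span-odd k)) a+b≡ oct 0≤a 0≤b)
  where
  0≤a : + 0 ≤ a
  0≤a = proj₁ (sector-diagonal k a b sec)
  0≤b : + 0 ≤ b
  0≤b = proj₂ (sector-diagonal k a b sec)
  re-part : ∀ a D → a + - (+ 1 · D - + 1 · + 0) ≡ a - D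
  re-part = solve-∀
  im-part : ∀ b D → b + - (+ 1 · + 0 + + 1 · D) ≡ b - D
  im-part = solve-∀
  difference : (a + b i) ⊝ 1+i ⊗ two^ k ≡ (a - 2^ k) + (b - 2^ k) i
  difference = cong₂ _+_i (re-part a (2^ k)) (im-part b (2^ k))

axial-step : ∀ k y → OddOctagon (suc (suc (suc (2 * k)))) y → Sector (two^ (suc k)) y →
             OddOctagon (suc (suc (2 * k))) (y ⊝ two^ (suc k))
axial-step k (a + b i) ((c , a+b≡) , oct) sec =
  subst Odd (cong ((a + b i) ⊝_) two^-suc≡) (Odd-⊝-1+i⊗ (a + b i) ((1𝔾 ⊝ i𝔾) ⊗ two^ k) (c , a+b≡)) ,
  subst (Octagon (width (suc (suc (2 * k)))) (span (suc (suc (2 * k))))) (sym difference)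
        (axial-step′ (2^ k) (width (suc (2 * k))) (span (suc (2 * k))) a b (1≤2^ k)
                     (proj₁ (width-span-odd k)) (proj₂ (width-span-odd k)) oct (sector-axial (suc k) a b sec))
  where
  halve : ∀ t → 1+i ⊗ ((1𝔾 ⊝ i𝔾) ⊗ t) ≡ two^ 1 ⊗ t
  halve = RingSolver.solve-∀ 𝔾-ring
  two^-suc≡ : 1+i ⊗ ((1𝔾 ⊝ i𝔾) ⊗ two^ k) ≡ two^ (suc k)
  two^-suc≡ = trans (halve (two^ k)) (sym (two^-suc k))
  re-part : ∀ a D → a + - D ≡ a - D
  re-part = solve-∀
  difference : (a + b i) ⊝ two^ (suc k) ≡ (a - + 2 · 2^ k) + b i
  difference = cong₂ _+_i (trans (re-part a (2^ (suc k))) (cong (λ x → a - x) (2^-suc k))) (ℤₚ.+-identityʳ b)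

base-step : ∀ y → OddOctagon 1 y → Sector 1𝔾 y → y ⊝ 1𝔾 ≡ 0𝔾
base-step (a + b i) ((c , a+b≡) , oct) sec =
  cong₂ _+_i (cong (_+ - + 1) (proj₁ a≡1×b≡0)) (cong (_+ - + 0) (proj₂ a≡1×b≡0))
  where
  a≡1×b≡0 : a ≡ + 1 × b ≡ + 0
  a≡1×b≡0 = base-step′ a b c a+b≡ oct (sector-axial 0 a b sec)

data Shape : ℕ → Set where
  base : Shape 0
  2k+1 : ∀ k → Shape (suc (2 * k))
  2k+2 : ∀ k → Shape (suc (suc (2 * k)))

shape : ∀ m → Shape m
shape zero = base
shape (suc m) with shape m
... | base   = 2k+1 0
... | 2k+1 k = 2k+2 k
... | 2k+2 k = subst Shape (cong suc (ℕₚ.*-suc 2 k)) (2k+1 (suc k))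

Motzkin₀ : ℕ → 𝔾 → Set
Motzkin₀ m x = Motzkin m x ⊎ x ≡ 0𝔾

rotate-canonical-direction :
  ∀ {Q R : 𝔾 → Set} {m} c k → 1+i ^𝔾 m ≡ i𝔾 ^𝔾 k ⊗ c → ρ-Invariant Q → ρ-Invariant R →
  (∀ y → Q y → Sector c y → R (y ⊝ c)) →
  ∀ j y → Q y → Sector (i𝔾 ^𝔾 j ⊗ (1+i ^𝔾 m)) y → R (y ⊝ i𝔾 ^𝔾 j ⊗ (1+i ^𝔾 m))
rotate-canonical-direction {Q} {R} {m} c k 1+i^m≡ Qρ Rρ H j y Qy sec =
  subst (λ d → R (y ⊝ d)) (sym direction)
        (rotate-direction c Qρ Rρ H (j ℕ.+ k) y Qy (subst (λ d → Sector d y) direction sec))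
  where
  direction : i𝔾 ^𝔾 j ⊗ (1+i ^𝔾 m) ≡ i𝔾 ^𝔾 (j ℕ.+ k) ⊗ c
  direction = trans (cong (i𝔾 ^𝔾 j ⊗_) 1+i^m≡)
                    (trans (sym (⊗-assoc (i𝔾 ^𝔾 j) (i𝔾 ^𝔾 k) c)) (cong (_⊗ c) (sym (^𝔾-+ i𝔾 j k))))

OddStep : ℕ → Set
OddStep m = ∀ j y → OddOctagon (suc m) y → Sector (i𝔾 ^𝔾 j ⊗ (1+i ^𝔾 m)) y →
            Motzkin₀ m (y ⊝ i𝔾 ^𝔾 j ⊗ (1+i ^𝔾 m))

-- The predicates and the level are given explicitly: unification cannot recover them.
odd-step-base : OddStep 0
odd-step-base j y Qy sec =
  inj₂ (rotate-direction {OddOctagon 1} {_≡ 0𝔾} 1𝔾 (OddOctagon-ρ {1}) zero-ρ base-step j y Qy sec)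
  where
  zero-ρ : ρ-Invariant (_≡ 0𝔾)
  zero-ρ _ refl = refl

odd-step-odd : ∀ k → OddStep (suc (2 * k))
odd-step-odd k j y Qy sec =
  inj₁ (inj₁ (rotate-canonical-direction {OddOctagon (suc (suc (2 * k)))} {OddOctagon (suc (2 * k))}
                {suc (2 * k)} (1+i ⊗ two^ k) k (1+i^-odd k)
                (OddOctagon-ρ {suc (suc (2 * k))}) (OddOctagon-ρ {suc (2 * k)}) (diagonal-step k) j y Qy sec))

odd-step-even : ∀ k → OddStep (suc (suc (2 * k)))
odd-step-even k j y Qy sec =
  inj₁ (inj₁ (rotate-canonical-direction {OddOctagon (suc (suc (suc (2 * k))))} {OddOctagon (suc (suc (2 * k)))}
                {suc (suc (2 * k))} (two^ (suc k)) (suc k) 1+i^≡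
                (OddOctagon-ρ {suc (suc (suc (2 * k)))}) (OddOctagon-ρ {suc (suc (2 * k))}) (axial-step k)
                j y Qy sec))
  where
  1+i^≡ : 1+i ^𝔾 suc (suc (2 * k)) ≡ i𝔾 ^𝔾 suc k ⊗ two^ (suc k)
  1+i^≡ = trans (cong (1+i ^𝔾_) (sym (ℕₚ.*-suc 2 k))) (1+i^-even (suc k))

odd-step : ∀ m → OddStep m
odd-step m = by-shape (shape m)
  where
  by-shape : ∀ {m} → Shape m → OddStep m
  by-shape base     = odd-step-base
  by-shape (2k+1 k) = odd-step-odd k
  by-shape (2k+2 k) = odd-step-even k

leading-digit : ∀ m j y → Motzkin (suc m) y → Sector (i𝔾 ^𝔾 j ⊗ (1+i ^𝔾 m)) y →
                Motzkin₀ m (y ⊝ i𝔾 ^𝔾 j ⊗ (1+i ^𝔾 m))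
leading-digit m       j y (inj₁ odd-oct)            sec = odd-step m j y odd-oct sec
leading-digit (suc m) j _ (inj₂ (z , refl , z∈)) sec =
  lift (leading-digit m j z z∈ (Sector-1+i⊗ d z (subst (λ e → Sector e (1+i ⊗ z)) direction sec)))
  where
  u = i𝔾 ^𝔾 j
  d = u ⊗ (1+i ^𝔾 m)
  pull : ∀ u p → u ⊗ (1+i ⊗ p) ≡ 1+i ⊗ (u ⊗ p)
  pull = RingSolver.solve-∀ 𝔾-ring
  factor-out : ∀ z u p → 1+i ⊗ z ⊝ u ⊗ (1+i ⊗ p) ≡ 1+i ⊗ (z ⊝ u ⊗ p)
  factor-out = RingSolver.solve-∀ 𝔾-ring
  direction : u ⊗ (1+i ^𝔾 suc m) ≡ 1+i ⊗ d
  direction = pull u (1+i ^𝔾 m)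
  factor : 1+i ⊗ z ⊝ u ⊗ (1+i ^𝔾 suc m) ≡ 1+i ⊗ (z ⊝ d)
  factor = factor-out z u (1+i ^𝔾 m)
  lift : Motzkin₀ m (z ⊝ d) → Motzkin₀ (suc m) (1+i ⊗ z ⊝ u ⊗ (1+i ^𝔾 suc m))
  lift (inj₁ r∈)  = inj₁ (inj₂ (z ⊝ d , factor , r∈))
  lift (inj₂ r≡0) = inj₂ (trans factor (cong (1+i ⊗_) r≡0))

snoc : ∀ {A : Set} {m} → (Fin m → A) → A → Fin (suc m) → A
snoc {m = zero}  u a _           = a
snoc {m = suc m} u a Fin.zero    = u Fin.zero
snoc {m = suc m} u a (Fin.suc j) = snoc (u ∘ Fin.suc) a j

snoc-last : ∀ {A : Set} m (u : Fin m → A) a → snoc u a (fromℕ m) ≡ a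
snoc-last zero    u a = refl
snoc-last (suc m) u a = snoc-last m (u ∘ Fin.suc) a

snoc-inject₁ : ∀ {A : Set} m (u : Fin m → A) a j → snoc u a (inject₁ j) ≡ u j
snoc-inject₁ (suc m) u a Fin.zero    = refl
snoc-inject₁ (suc m) u a (Fin.suc j) = snoc-inject₁ m (u ∘ Fin.suc) a j

sumFin-cong : ∀ n {f g : Fin n → 𝔾} → (∀ j → f j ≡ g j) → sumFin n f ≡ sumFin n g
sumFin-cong zero    f≡g = refl
sumFin-cong (suc n) f≡g = cong₂ _⊕_ (f≡g Fin.zero) (sumFin-cong n (f≡g ∘ Fin.suc))

sumFin-zero : ∀ n {f : Fin n → 𝔾} → (∀ j → f j ≡ 0𝔾) → sumFin n f ≡ 0𝔾
sumFin-zero zero    f≡0 = refl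
sumFin-zero (suc n) f≡0 = cong₂ _⊕_ (f≡0 Fin.zero) (sumFin-zero n (f≡0 ∘ Fin.suc))

sumFin-last : ∀ n (f : Fin (suc n) → 𝔾) → sumFin (suc n) f ≡ sumFin n (f ∘ inject₁) ⊕ f (fromℕ n)
sumFin-last zero    f = ⊕-comm (f Fin.zero) 0𝔾
sumFin-last (suc n) f =
  trans (cong (f Fin.zero ⊕_) (sumFin-last n (f ∘ Fin.suc))) (sym (⊕-assoc (f Fin.zero) _ _))

Expansion : ℕ → 𝔾 → Set
Expansion m y = Σ (Fin m → Digit) λ u → y ≡ expansion m u

expansion-zero : ∀ m → Expansion m 0𝔾
expansion-zero m = (λ _ → d0) , sym (sumFin-zero m (λ j → ⊗-zeroˡ (1+i ^𝔾 toℕ j)))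

expansion-snoc : ∀ m u δ → expansion (suc m) (snoc u δ) ≡ expansion m u ⊕ digit δ ⊗ (1+i ^𝔾 m)
expansion-snoc m u δ =
  trans (sumFin-last m (λ j → digit (snoc u δ j) ⊗ (1+i ^𝔾 toℕ j))) (cong₂ _⊕_ (sumFin-cong m earlier) last)
  where
  earlier : ∀ j → digit (snoc u δ (inject₁ j)) ⊗ (1+i ^𝔾 toℕ (inject₁ j))
                  ≡ digit (u j) ⊗ (1+i ^𝔾 toℕ j)
  earlier j = cong₂ (λ e n → digit e ⊗ (1+i ^𝔾 n)) (snoc-inject₁ m u δ j) (Finₚ.toℕ-inject₁ j)
  last : digit (snoc u δ (fromℕ m)) ⊗ (1+i ^𝔾 toℕ (fromℕ m)) ≡ digit δ ⊗ (1+i ^𝔾 m)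
  last = cong₂ (λ e n → digit e ⊗ (1+i ^𝔾 n)) (snoc-last m u δ) (Finₚ.toℕ-fromℕ m)

unit-digit : ∀ j → Σ Digit λ δ → digit δ ≡ i𝔾 ^𝔾 j
unit-digit 0 = d1 , refl
unit-digit 1 = di , refl
unit-digit 2 = d-1 , refl
unit-digit 3 = d-i , refl
unit-digit (suc (suc (suc (suc j)))) = proj₁ (unit-digit j) , trans (proj₂ (unit-digit j)) (sym (i⁴ (i𝔾 ^𝔾 j)))
  where
  i⁴ : ∀ u → i𝔾 ⊗ (i𝔾 ⊗ (i𝔾 ⊗ (i𝔾 ⊗ u))) ≡ u
  i⁴ = RingSolver.solve-∀ 𝔾-ring

-- ExpWithLead x k t is LeadingExpansion (2 * k) x t.
LeadingExpansion : ℕ → 𝔾 → 𝔾 → Set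
LeadingExpansion m y t =
  Σ (Fin (suc m) → Digit) λ u → (y ≡ expansion (suc m) u) × (digit (u (fromℕ m)) ⊗ (1+i ^𝔾 m) ≡ t)

append-leading-digit : ∀ m j y → Expansion m (y ⊝ i𝔾 ^𝔾 j ⊗ (1+i ^𝔾 m)) →
                       LeadingExpansion m y (i𝔾 ^𝔾 j ⊗ (1+i ^𝔾 m))
append-leading-digit m j y (u , r≡) =
  snoc u δ , y≡ , trans (cong (λ e → digit e ⊗ (1+i ^𝔾 m)) (snoc-last m u δ)) lead≡
  where
  open ≡-Reasoning
  d = i𝔾 ^𝔾 j ⊗ (1+i ^𝔾 m)
  δ = proj₁ (unit-digit j)
  lead≡ : digit δ ⊗ (1+i ^𝔾 m) ≡ d
  lead≡ = cong (_⊗ (1+i ^𝔾 m)) (proj₂ (unit-digit j))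
  split : ∀ y d → y ≡ (y ⊝ d) ⊕ d
  split = RingSolver.solve-∀ 𝔾-ring
  y≡ : y ≡ expansion (suc m) (snoc u δ)
  y≡ = begin
    y                                      ≡⟨ split y d ⟩
    (y ⊝ d) ⊕ d                            ≡⟨ cong₂ _⊕_ r≡ (sym lead≡) ⟩
    expansion m u ⊕ digit δ ⊗ (1+i ^𝔾 m)   ≡⟨ sym (expansion-snoc m u δ) ⟩
    expansion (suc m) (snoc u δ)           ∎

expansion-of₀ : ∀ m x → (∀ x → Motzkin m x → Expansion m x) → Motzkin₀ m x → Expansion m x
expansion-of₀ m x expand = [ expand x , (λ x≡0 → subst (Expansion m) (sym x≡0) (expansion-zero m)) ]′

expansion-of : ∀ m y → Motzkin m y → Expansion m y
expansion-of zero    y ()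
expansion-of (suc m) y y∈ =
  forget-lead (append-leading-digit m j y (expansion-of₀ m (y ⊝ i𝔾 ^𝔾 j ⊗ (1+i ^𝔾 m)) (expansion-of m)
                                                         (leading-digit m j y y∈ sec)))
  where
  j = proj₁ (sector-cover (1+i ^𝔾 m) y)
  sec : Sector (i𝔾 ^𝔾 j ⊗ (1+i ^𝔾 m)) y
  sec = proj₂ (sector-cover (1+i ^𝔾 m) y)
  forget-lead : ∀ {t} → LeadingExpansion m y t → Expansion (suc m) y
  forget-lead (u , y≡ , _) = u , y≡

leading-expansion : ∀ m j y → Motzkin (suc m) y → Sector (i𝔾 ^𝔾 j ⊗ (1+i ^𝔾 m)) y →
                    LeadingExpansion m y (i𝔾 ^𝔾 j ⊗ (1+i ^𝔾 m))
leading-expansion m j y y∈ sec =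
  append-leading-digit m j y (expansion-of₀ m (y ⊝ i𝔾 ^𝔾 j ⊗ (1+i ^𝔾 m)) (expansion-of m)
                                            (leading-digit m j y y∈ sec))

N : 𝔾 → ℤ
N (a + b i) = a · a + b · b

N-⊗ : ∀ x y → N (x ⊗ y) ≡ N x · N y
N-⊗ (a + b i) (c + d i) = lagrange a b c d
  where
  lagrange : ∀ a b c d → (a · c - b · d) · (a · c - b · d) + (a · d + b · c) · (a · d + b · c)
                       ≡ (a · a + b · b) · (c · c + d · d)
  lagrange = solve-∀

N-nonNeg : ∀ y → + 0 ≤ N y
N-nonNeg (a + b i) = sum-nonNeg a b
  where
  sum-nonNeg : ∀ a b → + 0 ≤ a · a + b · b
  sum-nonNeg a b = ≤-by (gap (square-nonNeg a) ⊞ gap (square-nonNeg b)) (solve (a ∷ b ∷ []))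

N-inside : ∀ {w s} r → Octagon w s r → N (r ⊕ r ⊝ 1+i) ≤ + 2 · ((+ 2 · w + + 1) · (+ 2 · w + + 1))
N-inside {w} (r₁ + r₂ i) (r₁-bound , r₂-bound , _) = bound r₁ r₂ r₁-bound r₂-bound
  where
  odd-bound : ∀ r → ∣ r ∣≤ w → ∣ r + r + - + 1 ∣≤ + 2 · w + + 1
  odd-bound r (r≥ , r≤) =
    ≤-by (gap r≥ ⊞ gap r≥) (solve (r ∷ w ∷ [])) , ≤-by (gap r≤ ⊞ gap r≤ ⊞ lit 2) (solve (r ∷ w ∷ []))
  bound : ∀ r₁ r₂ → ∣ r₁ ∣≤ w → ∣ r₂ ∣≤ w →
          (r₁ + r₁ + - + 1) · (r₁ + r₁ + - + 1) + (r₂ + r₂ + - + 1) · (r₂ + r₂ + - + 1)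
          ≤ + 2 · ((+ 2 · w + + 1) · (+ 2 · w + + 1))
  bound r₁ r₂ h₁ h₂ =
    ≤-by (gap (square-≤ _ (+ 2 · w + + 1) (odd-bound r₁ h₁)) ⊞
          gap (square-≤ _ (+ 2 · w + + 1) (odd-bound r₂ h₂)))
         (solve (r₁ ∷ r₂ ∷ w ∷ []))

axis-far : ∀ W S x z → + 0 ≤ W → + 0 ≤ S → S ≤ + 2 · W + + 2 → + 1 + W ≤ x →
           S · S + + 1 ≤ + 5 · (x · x + z · z)
axis-far W S x z 0≤W 0≤S S≤ W<x =
  ≤-by (gap S²≤ ⊞ gap x²≥1 ⊞ gap z²≥0 ⊞ gap z²≥0 ⊞ gap z²≥0 ⊞ gap z²≥0 ⊞ gap z²≥0) (solve vs)
  where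
  vs = W ∷ S ∷ x ∷ z ∷ []
  z²≥0 : + 0 ≤ z · z
  z²≥0 = square-nonNeg z
  S²≤ : S · S ≤ (+ 2 · x) · (+ 2 · x)
  S²≤ = square-≤ S (+ 2 · x) (≤-by (gap 0≤S ⊞ gap W<x ⊞ gap W<x ⊞ gap 0≤W ⊞ gap 0≤W ⊞ lit 2) (solve vs) ,
                              ≤-by (gap S≤ ⊞ gap W<x ⊞ gap W<x) (solve vs))
  x²≥1 : + 1 · + 1 ≤ x · x
  x²≥1 = square-≥ (+ 1) x (ℤ.+≤+ ℕ.z≤n) (≤-by (gap W<x ⊞ gap 0≤W) (solve vs))

diagonal-far : ∀ S x z → + 0 ≤ S → + 1 + S ≤ x + z → S · S + + 1 ≤ + 5 · (x · x + z · z)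
diagonal-far S x z 0≤S S<x+z =
  ≤-by (gap S+1²≤ ⊞ gap (square-nonNeg (x - z)) ⊞ gap 0≤S ⊞ gap 0≤S
        ⊞ gap x²≥0 ⊞ gap x²≥0 ⊞ gap x²≥0 ⊞ gap z²≥0 ⊞ gap z²≥0 ⊞ gap z²≥0) (solve vs)
  where
  vs = S ∷ x ∷ z ∷ []
  x²≥0 : + 0 ≤ x · x
  x²≥0 = square-nonNeg x
  z²≥0 : + 0 ≤ z · z
  z²≥0 = square-nonNeg z
  S+1²≤ : (S + + 1) · (S + + 1) ≤ (x + z) · (x + z)
  S+1²≤ = square-≤ (S + + 1) (x + z) (≤-by (gap S<x+z ⊞ gap 0≤S ⊞ gap 0≤S ⊞ lit 2) (solve vs) ,
                                      ≤-by (gap S<x+z) (solve vs))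

N-outside : ∀ W S y → + 0 ≤ W → + 0 ≤ S → S ≤ + 2 · W + + 2 → ¬ Octagon W S y →
            S · S + + 1 ≤ + 5 · N y
N-outside W S (p + b i) 0≤W 0≤S S≤ ¬oct =
  by-cases (∣ p ∣≤? W) (∣ b ∣≤? W) (∣ p + b ∣≤? S) (∣ p - b ∣≤? S)
  where
  Goal : Set
  Goal = S · S + + 1 ≤ + 5 · (p · p + b · b)
  symmetric : ∀ x z → S · S + + 1 ≤ + 5 · (x · x + z · z) → x · x + z · z ≡ p · p + b · b → Goal
  symmetric x z h eq = subst (λ n → S · S + + 1 ≤ + 5 · n) eq h
  by-cases : Dec (∣ p ∣≤ W) → Dec (∣ b ∣≤ W) → Dec (∣ p + b ∣≤ S) → Dec (∣ p - b ∣≤ S) → Goal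
  by-cases (yes h₁) (yes h₂) (yes h₃) (yes h₄) = ⊥-elim (¬oct (h₁ , h₂ , h₃ , h₄))
  by-cases (no ¬h) _ _ _ =
    [ (λ h → axis-far W S p b 0≤W 0≤S S≤ h)
    , (λ h → symmetric (- p) b (axis-far W S (- p) b 0≤W 0≤S S≤ h) (solve (p ∷ b ∷ []))) ]′ (¬∣∣≤ ¬h)
  by-cases (yes _) (no ¬h) _ _ =
    [ (λ h → symmetric b p (axis-far W S b p 0≤W 0≤S S≤ h) (solve (p ∷ b ∷ [])))
    , (λ h → symmetric (- b) p (axis-far W S (- b) p 0≤W 0≤S S≤ h) (solve (p ∷ b ∷ []))) ]′ (¬∣∣≤ ¬h)
  by-cases (yes _) (yes _) (no ¬h) _ =
    [ (λ h → diagonal-far S p b 0≤S h)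
    , (λ h → symmetric (- p) (- b)
               (diagonal-far S (- p) (- b) 0≤S (subst (+ 1 + S ≤_) (ℤₚ.neg-distrib-+ p b) h))
               (solve (p ∷ b ∷ []))) ]′ (¬∣∣≤ ¬h)
  by-cases (yes _) (yes _) (yes _) (no ¬h) =
    [ (λ h → symmetric p (- b) (diagonal-far S p (- b) 0≤S h) (solve (p ∷ b ∷ [])))
    , (λ h → symmetric (- p) (- - b)
               (diagonal-far S (- p) (- - b) 0≤S (subst (+ 1 + S ≤_) (ℤₚ.neg-distrib-+ p (- b)) h))
               (solve (p ∷ b ∷ []))) ]′ (¬∣∣≤ ¬h)

norm-clash : ∀ M X T → M · X ≤ + 2 · T → + 10 ≤ M → T + + 1 ≤ + 5 · X → + 0 ≤ X → ⊥
norm-clash M X T MX≤ 10≤M T<5X 0≤X =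
  1≰0 (≤-by (gap MX≤ ⊞ gap 10≤M ⊠ gap 0≤X ⊞ gap T<5X ⊞ gap T<5X ⊞ lit 1) (solve (M ∷ X ∷ T ∷ [])))

-- The lower bound for Euclidean functions

-- A witness that f(y) ≥ m + 1 for every Euclidean function f (see motzkin-lower).
Obstruction : ℕ → 𝔾 → Set
Obstruction m y = Σ 𝔾 λ a → ∀ q r → a ≡ q ⊗ y ⊕ r → ¬ Motzkin m r × r ≢ 0𝔾

remainder≡ : ∀ a q y r → a ≡ q ⊗ y ⊕ r → r ≡ a ⊝ q ⊗ y
remainder≡ a q y r a≡ = trans (cancel r (q ⊗ y)) (cong (_⊝ q ⊗ y) (sym a≡))
  where
  cancel : ∀ r x → r ≡ (x ⊕ r) ⊝ x
  cancel = RingSolver.solve-∀ 𝔾-ring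

OddSquareCases : ℤ → Set
OddSquareCases q = q ≡ + 0 ⊎ q ≡ + 1 ⊎ + 9 ≤ (+ 1 + - (q + q)) · (+ 1 + - (q + q))

odd-square-cases : ∀ q → OddSquareCases q
odd-square-cases (+ 0)           = inj₁ refl
odd-square-cases (+ 1)           = inj₂ (inj₁ refl)
odd-square-cases (+ suc (suc n)) = inj₂ (inj₂ (large (+ suc (suc n)) (ℤ.+≤+ (ℕ.s≤s (ℕ.s≤s ℕ.z≤n)))))
  where
  large : ∀ q → + 2 ≤ q → + 9 ≤ (+ 1 + - (q + q)) · (+ 1 + - (q + q))
  large q 2≤q =
    ≤-by (gap (square-≥ (+ 3) (q + q - + 1) (ℤ.+≤+ ℕ.z≤n) (≤-by (gap 2≤q ⊞ gap 2≤q) (solve (q ∷ [])))))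
         (solve (q ∷ []))
odd-square-cases ℤ.-[1+ n ]      = inj₂ (inj₂ (large ℤ.-[1+ n ] (ℤ.-≤- ℕ.z≤n)))
  where
  large : ∀ q → q ≤ - + 1 → + 9 ≤ (+ 1 + - (q + q)) · (+ 1 + - (q + q))
  large q q≤-1 =
    ≤-by (gap (square-≥ (+ 3) (+ 1 + - (q + q)) (ℤ.+≤+ ℕ.z≤n) (≤-by (gap q≤-1 ⊞ gap q≤-1) (solve (q ∷ [])))))
         (solve (q ∷ []))

1≤odd-square : ∀ q → + 1 ≤ (+ 1 + - (q + q)) · (+ 1 + - (q + q))
1≤odd-square q with odd-square-cases q
... | inj₁ refl        = ℤₚ.≤-refl
... | inj₂ (inj₁ refl) = ℤₚ.≤-refl
... | inj₂ (inj₂ 9≤)   = ℤₚ.≤-trans (ℤ.+≤+ (ℕ.s≤s ℕ.z≤n)) 9≤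

-- The multiplier 1 + i - 2q has odd coordinates, so it is a unit times 1 + i or its norm is at least 10.
odd-multiplier : ∀ q → (∃[ j ] 1+i ⊝ (q ⊕ q) ≡ i𝔾 ^𝔾 j ⊗ 1+i) ⊎ + 10 ≤ N (1+i ⊝ (q ⊕ q))
odd-multiplier (q₁ + q₂ i) = combine q₁ q₂ (odd-square-cases q₁) (odd-square-cases q₂)
  where
  combine : ∀ q₁ q₂ → OddSquareCases q₁ → OddSquareCases q₂ →
            (∃[ j ] 1+i ⊝ ((q₁ + q₂ i) ⊕ (q₁ + q₂ i)) ≡ i𝔾 ^𝔾 j ⊗ 1+i) ⊎
            + 10 ≤ (+ 1 + - (q₁ + q₁)) · (+ 1 + - (q₁ + q₁)) + (+ 1 + - (q₂ + q₂)) · (+ 1 + - (q₂ + q₂))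
  combine _ _ (inj₁ refl)        (inj₁ refl)        = inj₁ (0 , refl)
  combine _ _ (inj₂ (inj₁ refl)) (inj₁ refl)        = inj₁ (1 , refl)
  combine _ _ (inj₂ (inj₁ refl)) (inj₂ (inj₁ refl)) = inj₁ (2 , refl)
  combine _ _ (inj₁ refl)        (inj₂ (inj₁ refl)) = inj₁ (3 , refl)
  combine q₁ q₂ (inj₂ (inj₂ 9≤)) _ =
    inj₂ (≤-by (gap 9≤ ⊞ gap (1≤odd-square q₂)) (solve (q₁ ∷ q₂ ∷ [])))
  combine _ q₂ (inj₁ refl) (inj₂ (inj₂ 9≤)) =
    inj₂ (≤-by (gap (1≤odd-square (+ 0)) ⊞ gap 9≤) (solve (q₂ ∷ [])))
  combine _ q₂ (inj₂ (inj₁ refl)) (inj₂ (inj₂ 9≤)) =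
    inj₂ (≤-by (gap (1≤odd-square (+ 1)) ⊞ gap 9≤) (solve (q₂ ∷ [])))

octagon-halving : ∀ {w s} r z → Octagon w s r → r ⊕ r ⊝ 1+i ≡ 1+i ⊗ z → Octagon (s + + 1) (+ 2 · w + + 1) z
octagon-halving {w} {s} (r₁ + r₂ i) z oct eq =
  subst (Octagon (s + + 1) (+ 2 · w + + 1)) (1+i⊗-injective (trans witness eq)) (halve oct)
  where
  re-part : ∀ r₁ r₂ → + 1 · (r₁ + r₂ - + 1) - + 1 · (r₂ - r₁) ≡ r₁ + r₁ + - + 1
  re-part = solve-∀
  im-part : ∀ r₁ r₂ → + 1 · (r₂ - r₁) + + 1 · (r₁ + r₂ - + 1) ≡ r₂ + r₂ + - + 1
  im-part = solve-∀
  witness : 1+i ⊗ ((r₁ + r₂ - + 1) + (r₂ - r₁) i) ≡ (r₁ + r₂ i) ⊕ (r₁ + r₂ i) ⊝ 1+i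
  witness = cong₂ _+_i (re-part r₁ r₂) (im-part r₁ r₂)
  vs = w ∷ s ∷ r₁ ∷ r₂ ∷ []
  halve : Octagon′ w s r₁ r₂ → Octagon′ (s + + 1) (+ 2 · w + + 1) (r₁ + r₂ - + 1) (r₂ - r₁)
  halve ((h₁ , h₂) , (h₃ , h₄) , (h₅ , h₆) , (h₇ , h₈)) =
    (≤-by (gap h₅) (solve vs) , ≤-by (gap h₆ ⊞ lit 2) (solve vs)) ,
    (≤-by (gap h₈ ⊞ lit 1) (solve vs) , ≤-by (gap h₇ ⊞ lit 1) (solve vs)) ,
    (≤-by (gap h₃ ⊞ gap h₃) (solve vs) , ≤-by (gap h₄ ⊞ gap h₄ ⊞ lit 2) (solve vs)) ,
    (≤-by (gap h₁ ⊞ gap h₁) (solve vs) , ≤-by (gap h₂ ⊞ gap h₂ ⊞ lit 2) (solve vs))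

doubled-remainder : ∀ a q y r → a ⊕ a ⊝ 1+i ≡ 1+i ⊗ y → a ≡ q ⊗ y ⊕ r →
                    r ⊕ r ⊝ 1+i ≡ (1+i ⊝ (q ⊕ q)) ⊗ y
doubled-remainder a q y r double-a a≡ = begin
  r ⊕ r ⊝ 1+i                        ≡⟨ cong (λ x → x ⊕ x ⊝ 1+i) (remainder≡ a q y r a≡) ⟩
  (a ⊝ q ⊗ y) ⊕ (a ⊝ q ⊗ y) ⊝ 1+i    ≡⟨ regroup a q y ⟩
  (a ⊕ a ⊝ 1+i) ⊝ (q ⊕ q) ⊗ y        ≡⟨ cong (_⊝ (q ⊕ q) ⊗ y) double-a ⟩
  1+i ⊗ y ⊝ (q ⊕ q) ⊗ y              ≡⟨ factor q y ⟩
  (1+i ⊝ (q ⊕ q)) ⊗ y                ∎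
  where
  open ≡-Reasoning
  regroup : ∀ a q y → (a ⊝ q ⊗ y) ⊕ (a ⊝ q ⊗ y) ⊝ 1+i ≡ (a ⊕ a ⊝ 1+i) ⊝ (q ⊕ q) ⊗ y
  regroup = RingSolver.solve-∀ 𝔾-ring
  factor : ∀ q y → 1+i ⊗ y ⊝ (q ⊕ q) ⊗ y ≡ (1+i ⊝ (q ⊕ q)) ⊗ y
  factor = RingSolver.solve-∀ 𝔾-ring

-- For p + b = 1 + 2c, the element (c - b + 1) + (c + 1) i is (1 + i)(y + 1)/2.
odd-witness-double : ∀ p b c → p + b ≡ + 1 + c · + 2 →
                     ((c - b + + 1) + (c + + 1) i) ⊕ ((c - b + + 1) + (c + + 1) i) ⊝ 1+i ≡ 1+i ⊗ (p + b i)
odd-witness-double p b c p+b≡ = cong₂ _+_i re-part im-part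
  where
  open ≡-Reasoning
  re-part : (c - b + + 1) + (c - b + + 1) + - + 1 ≡ + 1 · p - + 1 · b
  re-part = begin
    (c - b + + 1) + (c - b + + 1) + - + 1   ≡⟨ solve (b ∷ c ∷ []) ⟩
    (+ 1 + c · + 2) - (b + b)               ≡⟨ cong (_- (b + b)) (sym p+b≡) ⟩
    (p + b) - (b + b)                       ≡⟨ solve (p ∷ b ∷ []) ⟩
    + 1 · p - + 1 · b                       ∎
  im-part : (c + + 1) + (c + + 1) + - + 1 ≡ + 1 · b + + 1 · p
  im-part = begin
    (c + + 1) + (c + + 1) + - + 1   ≡⟨ solve (c ∷ []) ⟩
    + 1 + c · + 2                   ≡⟨ sym p+b≡ ⟩
    p + b                           ≡⟨ solve (p ∷ b ∷ []) ⟩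
    + 1 · b + + 1 · p               ∎

unit-multiplier : ∀ m y r j → Octagon (width m) (span m) r → r ⊕ r ⊝ 1+i ≡ (i𝔾 ^𝔾 j ⊗ 1+i) ⊗ y →
                  Octagon (width (suc m)) (span (suc m)) y
unit-multiplier m y r j r∈ 2r-1-i≡ =
  unit-invariant⁻¹ {Octagon (width (suc m)) (span (suc m))} Octagon-ρ⁻¹ j y
    (octagon-halving {width m} {span m} r (i𝔾 ^𝔾 j ⊗ y) r∈ (trans 2r-1-i≡ (unit-multiple (i𝔾 ^𝔾 j) y)))
  where
  unit-multiple : ∀ u y → (u ⊗ 1+i) ⊗ y ≡ 1+i ⊗ (u ⊗ y)
  unit-multiple = RingSolver.solve-∀ 𝔾-ring

large-multiplier : ∀ m y r μ → Octagon (width m) (span m) r → r ⊕ r ⊝ 1+i ≡ μ ⊗ y → + 10 ≤ N μ →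
                   ¬ Octagon (width (suc m)) (span (suc m)) y → ⊥
large-multiplier m y r μ r∈ 2r-1-i≡ 10≤Nμ y∉ =
  norm-clash (N μ) (N y) (S · S) Nμ·Ny≤ 10≤Nμ
    (N-outside (width (suc m)) S y (proj₁ (width-span-nonNeg (suc m))) (proj₂ (width-span-nonNeg (suc m)))
               (span≤2width+2 (suc m)) y∉)
    (N-nonNeg y)
  where
  S = span (suc m)
  Nμ·Ny≤ : N μ · N y ≤ + 2 · (S · S)
  Nμ·Ny≤ = subst (_≤ + 2 · (S · S)) (trans (cong N 2r-1-i≡) (N-⊗ μ y)) (N-inside {width m} {span m} r r∈)

remainder-outside : ∀ m y a → a ⊕ a ⊝ 1+i ≡ 1+i ⊗ y → ¬ Octagon (width (suc m)) (span (suc m)) y →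
                    ∀ q r → a ≡ q ⊗ y ⊕ r → ¬ Octagon (width m) (span m) r
remainder-outside m y a double-a y∉ q r a≡ r∈ = [ unit-case , large-case ]′ (odd-multiplier q)
  where
  2r-1-i≡ : r ⊕ r ⊝ 1+i ≡ (1+i ⊝ (q ⊕ q)) ⊗ y
  2r-1-i≡ = doubled-remainder a q y r double-a a≡
  unit-case : ∃[ j ] 1+i ⊝ (q ⊕ q) ≡ i𝔾 ^𝔾 j ⊗ 1+i → ⊥
  unit-case (j , unit) = y∉ (unit-multiplier m y r j r∈ (trans 2r-1-i≡ (cong (_⊗ y) unit)))
  large-case : + 10 ≤ N (1+i ⊝ (q ⊕ q)) → ⊥
  large-case 10≤N = large-multiplier m y r (1+i ⊝ (q ⊕ q)) r∈ 2r-1-i≡ 10≤N y∉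

odd-obstruction : ∀ m y → Odd y → ¬ Octagon (width (suc m)) (span (suc m)) y → Obstruction m y
odd-obstruction m (p + b i) (c , p+b≡) y∉ = a , λ q r a≡ →
  (λ r∈ → outside q r a≡ (Motzkin⊆Octagon m r r∈)) ,
  (λ r≡0 → outside q r a≡ (subst (Octagon (width m) (span m)) (sym r≡0) 0∈))
  where
  a : 𝔾
  a = (c - b + + 1) + (c + + 1) i
  0∈ : Octagon (width m) (span m) 0𝔾
  0∈ = Octagon-0 (proj₁ (width-span-nonNeg m)) (proj₂ (width-span-nonNeg m))
  outside : ∀ q r → a ≡ q ⊗ (p + b i) ⊕ r → ¬ Octagon (width m) (span m) r
  outside = remainder-outside m (p + b i) a (odd-witness-double p b c p+b≡) y∉

even-obstruction-zero : ∀ z → Obstruction 0 (1+i ⊗ z)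
even-obstruction-zero z =
  1𝔾 , λ q r 1≡ → (λ ()) , λ r≡0 → ¬Odd-1+i⊗ (q ⊗ z) (subst Odd (one≡even q r 1≡ r≡0) (+ 0 , refl))
  where
  absorb : ∀ q z → q ⊗ (1+i ⊗ z) ⊕ 0𝔾 ≡ 1+i ⊗ (q ⊗ z)
  absorb = RingSolver.solve-∀ 𝔾-ring
  one≡even : ∀ q r → 1𝔾 ≡ q ⊗ (1+i ⊗ z) ⊕ r → r ≡ 0𝔾 → 1𝔾 ≡ 1+i ⊗ (q ⊗ z)
  one≡even q r 1≡ r≡0 = trans 1≡ (trans (cong (q ⊗ (1+i ⊗ z) ⊕_) r≡0) (absorb q z))

even-obstruction : ∀ m z → Obstruction m z → Obstruction (suc m) (1+i ⊗ z)
even-obstruction m z (a , bad) = 1+i ⊗ a , λ q r a≡ →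
  let r≡ = r≡1+i⊗ q r a≡ in
  (λ { (inj₁ (odd , _))          → ¬Odd-1+i⊗ (a ⊝ q ⊗ z) (subst Odd r≡ odd)
     ; (inj₂ (r′ , r≡′ , r′∈)) → proj₁ (bad q (a ⊝ q ⊗ z) (split q))
                                       (subst (Motzkin m) (1+i⊗-injective (trans (sym r≡′) r≡)) r′∈) }) ,
  (λ r≡0 → proj₂ (bad q (a ⊝ q ⊗ z) (split q)) (1+i⊗-injective (trans (sym r≡) r≡0)))
  where
  factor : ∀ a q z → 1+i ⊗ a ⊝ q ⊗ (1+i ⊗ z) ≡ 1+i ⊗ (a ⊝ q ⊗ z)
  factor = RingSolver.solve-∀ 𝔾-ring
  split′ : ∀ a q z → a ≡ q ⊗ z ⊕ (a ⊝ q ⊗ z)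
  split′ = RingSolver.solve-∀ 𝔾-ring
  split : ∀ q → a ≡ q ⊗ z ⊕ (a ⊝ q ⊗ z)
  split q = split′ a q z
  r≡1+i⊗ : ∀ q r → 1+i ⊗ a ≡ q ⊗ (1+i ⊗ z) ⊕ r → r ≡ 1+i ⊗ (a ⊝ q ⊗ z)
  r≡1+i⊗ q r a≡ = trans (remainder≡ (1+i ⊗ a) q (1+i ⊗ z) r a≡) (factor a q z)

obstruction : ∀ m y → y ≢ 0𝔾 → ¬ Motzkin (suc m) y → Obstruction m y
obstruction m y y≢0 y∉ with odd-or-even y
... | inj₁ odd = odd-obstruction m y odd (λ oct → y∉ (inj₁ (odd , oct)))
obstruction zero    _ _   _  | inj₂ (z , refl) = even-obstruction-zero z
obstruction (suc m) _ y≢0 y∉ | inj₂ (z , refl) =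
  even-obstruction m z
    (obstruction m z (λ z≡0 → y≢0 (cong (1+i ⊗_) z≡0)) (λ z∈ → y∉ (inj₂ (z , refl , z∈))))

motzkin-lower : ∀ f → IsEuclidean f → ∀ m y (y≢0 : y ≢ 0𝔾) → f y y≢0 ℕ.< m → Motzkin m y
motzkin-lower f f-eucl zero    y y≢0 ()
motzkin-lower f f-eucl (suc m) y y≢0 fy<1+m = by-decision (Motzkin? (suc m) y)
  where
  by-decision : Dec (Motzkin (suc m) y) → Motzkin (suc m) y
  by-decision (yes y∈) = y∈
  by-decision (no y∉)  = ⊥-elim (refute (obstruction m y y≢0 y∉))
    where
    zero-quotient : ∀ y → 0𝔾 ≡ 0𝔾 ⊗ y ⊕ 0𝔾
    zero-quotient = RingSolver.solve-∀ 𝔾-ring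
    refute : Obstruction m y → ⊥
    refute (a , bad) = by-division (f-eucl a y a≢0 y≢0)
      where
      a≢0 : a ≢ 0𝔾
      a≢0 a≡0 = proj₂ (bad 0𝔾 0𝔾 (trans a≡0 (zero-quotient y))) refl
      by-division : Σ 𝔾 (λ q → Σ 𝔾 λ r → (a ≡ q ⊗ y ⊕ r) ×
                                          ((r ≡ 0𝔾) ⊎ (Σ (r ≢ 0𝔾) λ r≢0 → f r r≢0 ℕ.< f y y≢0))) → ⊥
      by-division (q , r , a≡ , inj₁ r≡0)           = proj₂ (bad q r a≡) r≡0
      by-division (q , r , a≡ , inj₂ (r≢0 , fr<fy)) =
        proj₁ (bad q r a≡) (motzkin-lower f f-eucl m r r≢0 (ℕₚ.<-≤-trans fr<fy (ℕₚ.≤-pred fy<1+m)))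

ExpWithLead-in-sector : ∀ k y → Motzkin (suc (2 * k)) y → ∀ e → Sector (i𝔾 ^𝔾 e) y →
                        ExpWithLead y k (i𝔾 ^𝔾 e ⊗ two^ k)
ExpWithLead-in-sector k y y∈ e sec =
  subst (LeadingExpansion (2 * k) y) direction (leading-expansion (2 * k) (e ℕ.+ 3 * k) y y∈ sec′)
  where
  open ≡-Reasoning
  u = i𝔾 ^𝔾 e
  t = two^ k
  regroup : ∀ u v w t → (u ⊗ v) ⊗ (w ⊗ t) ≡ u ⊗ ((w ⊗ v) ⊗ t)
  regroup = RingSolver.solve-∀ 𝔾-ring
  direction : i𝔾 ^𝔾 (e ℕ.+ 3 * k) ⊗ (1+i ^𝔾 (2 * k)) ≡ u ⊗ t
  direction = begin
    i𝔾 ^𝔾 (e ℕ.+ 3 * k) ⊗ (1+i ^𝔾 (2 * k))   ≡⟨ cong₂ _⊗_ (^𝔾-+ i𝔾 e (3 * k)) (1+i^-even k) ⟩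
    (u ⊗ i𝔾 ^𝔾 (3 * k)) ⊗ (i𝔾 ^𝔾 k ⊗ t)       ≡⟨ regroup u (i𝔾 ^𝔾 (3 * k)) (i𝔾 ^𝔾 k) t ⟩
    u ⊗ ((i𝔾 ^𝔾 k ⊗ i𝔾 ^𝔾 (3 * k)) ⊗ t)       ≡⟨ cong (λ x → u ⊗ (x ⊗ t)) (i^⊗i^3*≡1 k) ⟩
    u ⊗ (1𝔾 ⊗ t)                              ≡⟨ cong (u ⊗_) (⊗-identityˡ t) ⟩
    u ⊗ t                                     ∎
  sec′ : Sector (i𝔾 ^𝔾 (e ℕ.+ 3 * k) ⊗ (1+i ^𝔾 (2 * k))) y
  sec′ = subst (λ d → Sector d y) (trans (⊗-comm t u) (sym direction)) (Sector-scale k u y sec)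

lemma4p1 : (a b : ℤ) (nz : (a + b i) ≢ 0𝔾) (k : ℕ) →
    MinEuclValue (a + b i) nz (2 * k) →
      ((+ ∣ b ∣ ≤ a) → ExpWithLead (a + b i) k (two^ k))
    × ((+ ∣ b ∣ ≤ - a) → ExpWithLead (a + b i) k (⊖ two^ k))
    × ((+ ∣ a ∣ ≤ - b) → ExpWithLead (a + b i) k (⊖ (two^ k ⊗ i𝔾)))
    × ((+ ∣ a ∣ ≤ b) → ExpWithLead (a + b i) k (two^ k ⊗ i𝔾))
lemma4p1 a b nz k ((f , f-euclidean , f≡2k) , _) =
  (λ b≤a  → lead 0 (⊗-identityˡ (two^ k)) (unit-sector-0 a b b≤a)) ,
  (λ b≤-a → lead 2 (i²⊗ (two^ k)) (unit-sector-2 a b b≤-a)) ,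
  (λ a≤-b → lead 3 (i³⊗ (two^ k)) (unit-sector-3 a b a≤-b)) ,
  (λ a≤b  → lead 1 (i¹⊗ (two^ k)) (unit-sector-1 a b a≤b))
  where
  y∈ : Motzkin (suc (2 * k)) (a + b i)
  y∈ = motzkin-lower f f-euclidean (suc (2 * k)) (a + b i) nz
                     (subst (ℕ._< suc (2 * k)) (sym f≡2k) (ℕₚ.n<1+n (2 * k)))
  lead : ∀ e {t} → i𝔾 ^𝔾 e ⊗ two^ k ≡ t → Sector (i𝔾 ^𝔾 e) (a + b i) → ExpWithLead (a + b i) k t
  lead e t≡ sec = subst (ExpWithLead (a + b i) k) t≡ (ExpWithLead-in-sector k (a + b i) y∈ e sec)
  i¹⊗ : ∀ t → i𝔾 ^𝔾 1 ⊗ t ≡ t ⊗ i𝔾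
  i¹⊗ = RingSolver.solve-∀ 𝔾-ring
  i²⊗ : ∀ t → i𝔾 ^𝔾 2 ⊗ t ≡ ⊖ t
  i²⊗ = RingSolver.solve-∀ 𝔾-ring
  i³⊗ : ∀ t → i𝔾 ^𝔾 3 ⊗ t ≡ ⊖ (t ⊗ i𝔾)
  i³⊗ = RingSolver.solve-∀ 𝔾-ring
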